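{- Let $\mathcal O$ be a non-degenerate conic of $\mathrm{PG}(2,q^2)$. (1) If $\mathcal O$ is secant to $\ell_\infty$, with $\mathcal O\cap\ell_\infty=\{\bar P,\bar Q\}$, then (a) in $\mathrm{PG}(4,q)$, $[\mathcal O]\cap\Sigma_\infty=[P]\cup[Q]$; (b) in $\mathrm{PG}(4,q^2)$, $[\mathcal O]^\star\cap\Sigma_\infty^\star$ is the union of the four lines $[P]^\star,[Q]^\star,PQ^q,P^qQ$; (c) in $\mathrm{PG}(4,q^4)$, $[\mathcal O]^{\star\star}\cap\Sigma_\infty^{\star\star}$ is the union of the extensions to $\mathrm{PG}(4,q^4)$ of these four lines. (2) If $\mathcal O$ is tangent to $\ell_\infty$, with $\mathcal O\cap\ell_\infty=\{\bar P\}$, then $[\mathcal O]\cap\Sigma_\infty=[P]$, $[\mathcal O]^\star\cap\Sigma_\infty^\star=[P]^\star$, and $[\mathcal O]^{\star\star}\cap\Sigma_\infty^{\star\star}=[P]^{\star\star}$. (3) If $\mathcal O$ is exterior to $\ell_\infty$, so that in $\mathrm{PG}(2,q^4)$ the extension of $\mathcal O$ meets the extension of $\ell_\infty$ in two points $\bar P,\bar P^{q^2}$, then $[\mathcal O]\cap\Sigma_\infty=\emptyset$, $[\mathcal O]^\star\cap\Sigma_\infty^\star=\emptyset$, and $[\mathcal O]^{\star\star}\cap\Sigma_\infty^{\star\star}$ is the union of the four lines $\ell_P,\ell_P^q,\ell_P^{q^2},\ell_P^{q^3}$, where $\ell_P=PP^q$.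
   Context: Bruck–Bose setting: $q$ is a prime power; $\tau$ is a primitive element of $\mathbb F_{q^2}$ with minimal polynomial $x^2-t_1x-t_0$ over $\mathbb F_q$. In $\mathrm{PG}(2,q^2)$, $\ell_\infty$ is $z=0$; in $\mathrm{PG}(4,q)$ with coordinates $(x_0,x_1,y_0,y_1,z)$, $\Sigma_\infty$ is $z=0$. The affine point $(x_0+x_1\tau,y_0+y_1\tau,1)$ corresponds to $(x_0,x_1,y_0,y_1,1)$; a point $\bar T=(d_0+d_1\tau,1,0)$ of $\ell_\infty$ corresponds to the spread line $[T]=\langle(d_0,d_1,1,0,0),(t_0d_1,d_0+t_1d_1,0,1,0)\rangle$, and $(1,0,0)$ to $\langle(1,0,0,0,0),(0,1,0,0,0)\rangle$. For a point $X$ (or line $\ell$) of $\mathrm{PG}(4,q^k)$, $X^q$ ($\ell^q$) is its image under raising all coordinates to the $q$-th power. The transversals of the spread are $g=\langle A_0,A_1\rangle$, $g^q$ with $A_0=(\tau^q,-1,0,0,0)$, $A_1=(0,0,\tau^q,-1,0)$. A point $\bar P=(\alpha,1,0)$ of the extension of $\ell_\infty$ to $\mathrm{PG}(2,q^4)$, $\alpha\in\mathbb F_{q^4}$, corresponds to $P=\alpha A_0+A_1$, and $(1,0,0)$ to $P=A_0$. If $\mathcal O$ has equation $f=0$ over $\mathbb F_{q^2}$, writing $x=x_0+x_1\tau$, $y=y_0+y_1\tau$, $z\in\mathbb F_q$ gives $f=f_\infty+\tau f_0$ with $f_\infty,f_0$ quadratic forms over $\mathbb F_q$; $[\mathcal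 O]$ is the intersection of the quadrics $f_\infty=0$ and $f_0=0$ in $\mathrm{PG}(4,q)$ (its affine points are the images of the affine points of $\mathcal O$). For a point set $\mathcal V$ of $\mathrm{PG}(4,q)$ defined by homogeneous equations over $\mathbb F_q$, $\mathcal V^\star$ (resp. $\mathcal V^{\star\star}$) is the set of points of $\mathrm{PG}(4,q^2)$ (resp. $\mathrm{PG}(4,q^4)$) satisfying the same equations. -}

module Defs where

open import Level using (0ℓ)
open import Data.Nat as ℕ using (ℕ; zero; suc)
open import Data.Nat.Primality using (Prime)
open import Data.List using (List; length)
open import Data.List.Relation.Unary.Any using (Any)
open import Data.List.Relation.Unary.AllPairs using (AllPairs)
open import Data.Product using (Σ; ∃; _×_; _,_)
open import Data.Sum using (_⊎_)
open import Data.Unit using (⊤)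
open import Data.Empty using (⊥)
open import Relation.Nullary using (¬_)
open import Relation.Binary.PropositionalEquality using (_≡_)
open import Algebra.Bundles using (CommutativeRing)

-- Fields (the stdlib has no Field bundle): a commutative ring with a
-- total inverse operation that is a genuine inverse on nonzero elements.

record FField : Set₁ where
  field
    commRing : CommutativeRing 0ℓ 0ℓ
  open CommutativeRing commRing public
  field
    _⁻¹      : Carrier → Carrier
    ⁻¹-inv   : ∀ x → ¬ (x ≈ 0#) → x * (x ⁻¹) ≈ 1#
    0≉1      : ¬ (0# ≈ 1#)

IsPrimePower : ℕ → Set
IsPrimePower q = Σ ℕ λ p → Σ ℕ λ k → Prime p × q ≡ p ℕ.^ suc k

module _ (K : FField) where
  open FField K

  HasOrder : ℕ → Set
  HasOrder n = Σ (List Carrier) λ xs →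
    ((x : Carrier) → Any (x ≈_) xs) × AllPairs (λ x y → ¬ (x ≈ y)) xs × length xs ≡ n

-- Everything below lives in a fixed field K (intended K = F_{q^4}),
-- with q the order of the prime subfield-power F_q ⊆ K.

record P5 (A : Set) : Set where
  constructor pt5
  field x0 x1 y0 y1 z : A

record Conic (A : Set) : Set where
  constructor conic
  -- a x² + b y² + c z² + f yz + g xz + h xy
  field a b c f g h : A

-- points of ℓ∞ : (α,1,0) or (1,0,0)
data LPt (A : Set) : Set where
  aff  : A → LPt A
  vert : LPt A

module Geometry (K : FField) (q : ℕ) (τ : FField.Carrier K) where
  open FField K
  open P5
  open Conic

  _^_ : Carrier → ℕ → Carrier
  x ^ zero  = 1#
  x ^ suc n = x * (x ^ n)

  InF : ℕ → Carrier → Set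
  InF k a = a ^ (q ℕ.^ k) ≈ a

  τq : Carrier
  τq = τ ^ q

  -- τ − τ^q (nonzero since τ ∉ F_q)
  δ : Carrier
  δ = τ + (- τq)

  _≈5_ : P5 Carrier → P5 Carrier → Set
  X ≈5 Y = (x0 X ≈ x0 Y) × (x1 X ≈ x1 Y) × (y0 X ≈ y0 Y) × (y1 X ≈ y1 Y) × (z X ≈ z Y)

  _·5_ : Carrier → P5 Carrier → P5 Carrier
  l ·5 X = pt5 (l * x0 X) (l * x1 X) (l * y0 X) (l * y1 X) (l * z X)

  _+5_ : P5 Carrier → P5 Carrier → P5 Carrier
  X +5 Y = pt5 (x0 X + x0 Y) (x1 X + x1 Y) (y0 X + y0 Y) (y1 X + y1 Y) (z X + z Y)

  Frob5 : P5 Carrier → P5 Carrier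
  Frob5 X = pt5 (x0 X ^ q) (x1 X ^ q) (y0 X ^ q) (y1 X ^ q) (z X ^ q)

  Frob5^ : ℕ → P5 Carrier → P5 Carrier
  Frob5^ zero X = X
  Frob5^ (suc n) X = Frob5 (Frob5^ n X)

  Rat5 : ℕ → P5 Carrier → Set
  Rat5 k X = InF k (x0 X) × InF k (x1 X) × InF k (y0 X) × InF k (y1 X) × InF k (z X)

  Zero5 : P5 Carrier → Set
  Zero5 X = X ≈5 pt5 0# 0# 0# 0# 0#

  PtPG : ℕ → P5 Carrier → Set
  PtPG k X = Rat5 k X × ¬ Zero5 X

  PSet : Set₁
  PSet = P5 Carrier → Set

  _∪_ : PSet → PSet → PSet
  (A ∪ B) X = A X ⊎ B X

  _∩_ : PSet → PSet → PSet
  (A ∩ B) X = A X × B X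

  Line : ℕ → P5 Carrier → P5 Carrier → PSet
  Line k U V X = Σ Carrier λ l → Σ Carrier λ m →
    InF k l × InF k m × X ≈5 ((l ·5 U) +5 (m ·5 V))

  SetEqPG : ℕ → PSet → PSet → Set
  SetEqPG k A B = (X : P5 Carrier) → PtPG k X → (A X → B X) × (B X → A X)

  EmptyPG : ℕ → PSet → Set
  EmptyPG k A = (X : P5 Carrier) → PtPG k X → ¬ A X

  Σ∞ : PSet
  Σ∞ X = z X ≈ 0#

  evalC : Conic Carrier → Carrier → Carrier → Carrier → Carrier
  evalC C x y w = a C * (x * x) + b C * (y * y) + c C * (w * w)
                + f C * (y * w) + g C * (x * w) + h C * (x * y)

  ConicOver : ℕ → Conic Carrier → Set
  ConicOver k C = InF k (a C) × InF k (b C) × InF k (c C) × InF k (f C) × InF k (g C) × InF k (h C)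

  four : Carrier
  four = 1# + 1# + 1# + 1#

  NonDegenerate : Conic Carrier → Set
  NonDegenerate C = ¬ ((four * a C * b C * c C + - (a C * (f C * f C)) + - (b C * (g C * g C))
                        + - (c C * (h C * h C)) + f C * g C * h C) ≈ 0#)

  conjC : Conic Carrier → Conic Carrier
  conjC C = conic (a C ^ q) (b C ^ q) (c C ^ q) (f C ^ q) (g C ^ q) (h C ^ q)

  FC : Conic Carrier → P5 Carrier → Carrier
  FC C X = evalC C (x0 X + x1 X * τ) (y0 X + y1 X * τ) (z X)

  FCbar : Conic Carrier → P5 Carrier → Carrier
  FCbar C X = evalC (conjC C) (x0 X + x1 X * τq) (y0 X + y1 X * τq) (z X)

  -- f = f∞ + τ f0 with f∞, f0 quadratic forms over F_q
  f0 : Conic Carrier → P5 Carrier → Carrier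
  f0 C X = (FC C X + - FCbar C X) * (δ ⁻¹)

  f∞ : Conic Carrier → P5 Carrier → Carrier
  f∞ C X = FC C X + - (τ * f0 C X)

  -- [O] (and, read over larger subfields, [O]^⋆ and [O]^⋆⋆)
  [O] : Conic Carrier → PSet
  [O] C X = (f∞ C X ≈ 0#) × (f0 C X ≈ 0#)

  RatL : ℕ → LPt Carrier → Set
  RatL k (aff α) = InF k α
  RatL k vert    = ⊤

  _~L_ : LPt Carrier → LPt Carrier → Set
  aff α ~L aff β = α ≈ β
  aff _ ~L vert  = ⊥
  vert  ~L aff _ = ⊥
  vert  ~L vert  = ⊤

  OnConicL : Conic Carrier → LPt Carrier → Set
  OnConicL C (aff α) = evalC C α 1# 0# ≈ 0#
  OnConicL C vert    = evalC C 1# 0# 0# ≈ 0#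

  -- spread line [T] of a point T of ℓ∞ (of PG(2,q^2)); t0 t1 from x²−t1x−t0
  module Spread (t0 t1 : Carrier) where
    d1 : Carrier → Carrier
    d1 α = (α + - (α ^ q)) * (δ ⁻¹)
    d0 : Carrier → Carrier
    d0 α = α + - (d1 α * τ)

    spreadU spreadV : LPt Carrier → P5 Carrier
    spreadU (aff α) = pt5 (d0 α) (d1 α) 1# 0# 0#
    spreadU vert    = pt5 1# 0# 0# 0# 0#
    spreadV (aff α) = pt5 (t0 * d1 α) (d0 α + t1 * d1 α) 0# 1# 0#
    spreadV vert    = pt5 0# 1# 0# 0# 0#

    -- [T] as a line of PG(4,q^k) (k = 1: [T]; k = 2: [T]^⋆; k = 4: [T]^⋆⋆)
    [_]^ : LPt Carrier → ℕ → PSet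
    [ T ]^ k = Line k (spreadU T) (spreadV T)

  A0 A1 : P5 Carrier
  A0 = pt5 τq (- 1#) 0# 0# 0#
  A1 = pt5 0# 0# τq (- 1#) 0#

  -- the point P ∈ g of PG(4,q^4) corresponding to P̄ ∈ ℓ∞
  gPt : LPt Carrier → P5 Carrier
  gPt (aff α) = (α ·5 A0) +5 A1
  gPt vert    = A0

module Submission where

-- Work in the field K of order q⁴.  To a vector X of PG(4,·) attach
-- the pair (x, y) = (x0 + x1 τ, y0 + y1 τ) and its conjugate (x̄, ȳ) obtained
-- with τ^q.  On Σ∞ the two equations of [O] amount to f(x, y, 0) = 0 and
-- f̄(x̄, ȳ, 0) = 0, and the binary form f(x, y, 0) factorises over K as
-- κ · ℓ_r1 · ℓ_r2, where r1, r2 are the points of O on ℓ∞ (over K).  Hence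
-- X ∈ [O] ∩ Σ∞ iff (x : y) ∈ {r1, r2} and (x̄ : ȳ) ∈ {r1^q, r2^q}.  The points
-- of Σ∞ with (x : y) = r and (x̄ : ȳ) = s form the line joining the point of
-- the transversal g over r to the point of g^q over s; the spread line [T]
-- is the case (T, T^q), and the Frobenius map interchanges g and g^q.  The
-- three cases of the theorem then just list the four combinations (r, s).

open import Level using (0ℓ)
open import Algebra.Bundles using (CommutativeRing; CommutativeMonoid; RawRing)
open import Data.Nat as ℕ using (ℕ; zero; suc; _∸_)
import Data.Nat.Properties as ℕP
open import Data.Nat.Primality using (Prime)
open import Data.Product using (Σ; _×_; _,_; proj₁; proj₂)
open import Data.Sum using (_⊎_; inj₁; inj₂; [_,_])
open import Data.Empty using (⊥; ⊥-elim)
open import Data.Unit using (tt)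
open import Data.List using (List; []; _∷_; length; map)
open import Data.List.Relation.Unary.Any using (Any; here; there)
open import Data.List.Relation.Unary.All using (All; []; _∷_; lookupAny)
open import Data.List.Relation.Unary.AllPairs using (AllPairs; []; _∷_)
open import Relation.Nullary using (¬_; Dec; yes; no)
open import Relation.Binary.PropositionalEquality as Eq using (_≡_)
open import Defs

-- The integers are represented by pairs (a , b) of naturals standing for
-- a − b, normalised so that one component is zero; this makes equality of
-- coefficients decidable, which is what Algebra.Solver.Ring requires.
module IntegerRingSolver (CR : CommutativeRing 0ℓ 0ℓ) where
  open CommutativeRing CR
  open import Relation.Binary.Reasoning.Setoid setoid
  open import Algebra.Solver.Ring.AlmostCommutativeRing
    using (AlmostCommutativeRing; fromCommutativeRing; _-Raw-AlmostCommutative⟶_)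
  import Algebra.Solver.Ring as RingSolver
  open import Algebra.Properties.Semiring.Mult semiring using (×1-homo-*) renaming (_×_ to _·_)
  open import Algebra.Properties.Monoid.Mult +-monoid using (×-homo-+)
  open import Algebra.Properties.Ring ring using (-‿distribˡ-*; -‿distribʳ-*; -‿involutive; -‿+-comm; -0#≈0#)
  open import Data.Maybe using (Maybe; just; nothing)

  Coefficient : Set
  Coefficient = ℕ × ℕ

  normalise : ℕ → ℕ → Coefficient
  normalise a b = (a ∸ b , b ∸ a)

  coefficient-rawRing : RawRing 0ℓ 0ℓ
  coefficient-rawRing = record
    { Carrier = Coefficient
    ; _≈_ = _≡_
    ; _+_ = λ { (a , b) (c , d) → normalise (a ℕ.+ c) (b ℕ.+ d) }
    ; _*_ = λ { (a , b) (c , d) → normalise (a ℕ.* c ℕ.+ b ℕ.* d) (a ℕ.* d ℕ.+ b ℕ.* c) }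
    ; -_ = λ { (a , b) → (b , a) }
    ; 0# = (0 , 0)
    ; 1# = (1 , 0)
    }

  nat : ℕ → Carrier
  nat n = n · 1#

  ⟦_⟧ℤ : Coefficient → Carrier
  ⟦ (a , b) ⟧ℤ = nat a + - nat b

  +-minus-interchange : ∀ A B C D → (A + C) + - (B + D) ≈ (A + - B) + (C + - D)
  +-minus-interchange A B C D = begin
    (A + C) + - (B + D)   ≈⟨ +-congˡ (sym (-‿+-comm B D)) ⟩
    (A + C) + (- B + - D) ≈⟨ +-assoc _ _ _ ⟩
    A + (C + (- B + - D)) ≈⟨ +-congˡ (sym (+-assoc _ _ _)) ⟩
    A + ((C + - B) + - D) ≈⟨ +-congˡ (+-congʳ (+-comm _ _)) ⟩
    A + ((- B + C) + - D) ≈⟨ +-congˡ (+-assoc _ _ _) ⟩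
    A + (- B + (C + - D)) ≈⟨ sym (+-assoc _ _ _) ⟩
    (A + - B) + (C + - D) ∎

  *-minus-expand : ∀ A B C D → (A * C + B * D) + - (A * D + B * C) ≈ (A + - B) * (C + - D)
  *-minus-expand A B C D = sym (begin
    (A + - B) * (C + - D)                             ≈⟨ distribʳ (C + - D) A (- B) ⟩
    A * (C + - D) + (- B) * (C + - D)                 ≈⟨ +-cong (distribˡ A C (- D)) (distribˡ (- B) C (- D)) ⟩
    (A * C + A * (- D)) + ((- B) * C + (- B) * (- D)) ≈⟨ +-cong (+-congˡ AD) (+-cong BC BD) ⟩
    (A * C + - (A * D)) + (- (B * C) + B * D)         ≈⟨ +-congˡ (+-comm _ _) ⟩
    (A * C + - (A * D)) + (B * D + - (B * C))         ≈⟨ sym (+-minus-interchange (A * C) (A * D) (B * D) (B * C)) ⟩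
    (A * C + B * D) + - (A * D + B * C)               ∎)
    where
    AD = sym (-‿distribʳ-* A D)
    BC = sym (-‿distribˡ-* B C)
    BD = trans (sym (-‿distribˡ-* B (- D))) (trans (-‿cong (sym (-‿distribʳ-* B D))) (-‿involutive _))

  normalise-sound : ∀ a b → ⟦ normalise a b ⟧ℤ ≈ ⟦ (a , b) ⟧ℤ
  normalise-sound zero    zero    = refl
  normalise-sound zero    (suc b) = refl
  normalise-sound (suc a) zero    = refl
  normalise-sound (suc a) (suc b) = trans (normalise-sound a b) (sym cancel-one)
    where
    cancel-one : (1# + nat a) + - (1# + nat b) ≈ nat a + - nat b
    cancel-one = trans (+-minus-interchange 1# 1# (nat a) (nat b)) (trans (+-congʳ (-‿inverseʳ 1#)) (+-identityˡ _))

  ⟦⟧-homomorphism : coefficient-rawRing -Raw-AlmostCommutative⟶ fromCommutativeRing CR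
  ⟦⟧-homomorphism = record
    { ⟦_⟧ = ⟦_⟧ℤ
    ; +-homo = λ { (a , b) (c , d) → trans (normalise-sound (a ℕ.+ c) (b ℕ.+ d))
        (trans (minus-cong (×-homo-+ 1# a c) (×-homo-+ 1# b d)) (+-minus-interchange (nat a) (nat b) (nat c) (nat d))) }
    ; *-homo = λ { (a , b) (c , d) → trans (normalise-sound (a ℕ.* c ℕ.+ b ℕ.* d) (a ℕ.* d ℕ.+ b ℕ.* c))
        (trans (minus-cong (nat-sum-of-products a c b d) (nat-sum-of-products a d b c)) (*-minus-expand (nat a) (nat b) (nat c) (nat d))) }
    ; -‿homo = λ { (a , b) → minus-swap (nat a) (nat b) }
    ; 0-homo = -‿inverseʳ 0#
    ; 1-homo = trans (+-congʳ (+-identityʳ 1#)) (trans (+-congˡ -0#≈0#) (+-identityʳ 1#))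
    }
    where
    minus-cong : ∀ {a b c d} → a ≈ b → c ≈ d → a + - c ≈ b + - d
    minus-cong e f = +-cong e (-‿cong f)
    minus-swap : ∀ A B → B + - A ≈ - (A + - B)
    minus-swap A B = trans (+-comm _ _) (trans (+-congˡ (sym (-‿involutive B))) (-‿+-comm A (- B)))
    nat-sum-of-products : ∀ a c b d → nat (a ℕ.* c ℕ.+ b ℕ.* d) ≈ nat a * nat c + nat b * nat d
    nat-sum-of-products a c b d = trans (×-homo-+ 1# (a ℕ.* c) (b ℕ.* d)) (+-cong (×1-homo-* a c) (×1-homo-* b d))

  -- normalised coefficients are equal iff they are syntactically equal
  coefficient-equality : ∀ x y → Maybe (⟦ x ⟧ℤ ≈ ⟦ y ⟧ℤ)
  coefficient-equality (a , b) (c , d) with a ℕ.≟ c | b ℕ.≟ d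
  ... | yes Eq.refl | yes Eq.refl = just refl
  ... | _           | _           = nothing

  open RingSolver coefficient-rawRing (fromCommutativeRing CR) ⟦⟧-homomorphism coefficient-equality public
    using (solve; _:=_; _:+_; _:*_; :-_; _:-_)

module PrimeBinomial where
  open import Data.Nat
  open import Data.Nat.Properties
  open import Data.Nat.Divisibility
  open import Data.Nat.Primality
  open import Data.Nat.Combinatorics
  open import Data.Nat.DivMod using (m*[n/m]≡n)
  open import Relation.Binary.PropositionalEquality using (sym; trans; cong; subst)

  prime>1 : ∀ {p} → Prime p → 1 < p
  prime>1 {p} pp = nonTrivial⇒n>1 p {{prime⇒nonTrivial pp}}

  prime-∤-factorial : ∀ {p} → Prime p → ∀ m → m < p → ¬ (p ∣ m !)
  prime-∤-factorial pp zero    m<p p∣1 = <⇒≢ (prime>1 pp) (sym (∣1⇒≡1 p∣1))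
  prime-∤-factorial pp (suc m) m<p p∣m! with euclidsLemma (suc m) (m !) pp p∣m!
  ... | inj₁ p∣1+m = <⇒≱ m<p (∣⇒≤ p∣1+m)
  ... | inj₂ p∣m!  = prime-∤-factorial pp m (<-trans (n<1+n m) m<p) p∣m!

  prime-∣-binomial : ∀ {p} → Prime p → ∀ k → 0 < k → k < p → p ∣ p C k
  prime-∣-binomial {p} pp k 0<k k<p with euclidsLemma (k ! * (p ∸ k) !) (p C k) pp p∣product
    where
    -- k! (p−k)! (p choose k) = p!, and p divides p!
    p∣product : p ∣ k ! * (p ∸ k) ! * (p C k)
    p∣product = subst (p ∣_) (sym (trans (cong (k ! * (p ∸ k) ! *_) (nCk≡n!/k![n-k]! (<⇒≤ k<p)))
                                          (m*[n/m]≡n {{k !* (p ∸ k) !≢0}} (k![n∸k]!∣n! (<⇒≤ k<p)))))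
                      (p∣p! p (<-trans 0<k k<p))
      where
      p∣p! : ∀ n → 0 < n → n ∣ n !
      p∣p! (suc n) _ = m∣m*n (n !)
  ... | inj₂ p∣binomial = p∣binomial
  ... | inj₁ p∣factorials with euclidsLemma (k !) ((p ∸ k) !) pp p∣factorials
  ...   | inj₁ p∣k! = ⊥-elim (prime-∤-factorial pp k k<p p∣k!)
  ...   | inj₂ p∣p-k! = ⊥-elim (prime-∤-factorial pp (p ∸ k) (∸-monoʳ-< 0<k (<⇒≤ k<p)) p∣p-k!)

module RearrangedFold (M : CommutativeMonoid 0ℓ 0ℓ) where
  open CommutativeMonoid M

  fold : List Carrier → Carrier
  fold []       = ε
  fold (x ∷ xs) = x ∙ fold xs

  remove : ∀ {y xs} → Any (y ≈_) xs → Σ Carrier λ x → Σ (List Carrier) λ xs' →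
    (y ≈ x) × (fold xs ≈ x ∙ fold xs') × (length xs ≡ suc (length xs')) ×
    (∀ {z} → Any (z ≈_) xs → z ≈ x ⊎ Any (z ≈_) xs')
  remove {xs = x ∷ xs} (here y≈x) = x , xs , y≈x , refl , Eq.refl , λ { (here z≈x) → inj₁ z≈x ; (there z∈) → inj₂ z∈ }
  remove {xs = x ∷ xs} (there y∈xs) with remove y∈xs
  ... | w , ws , y≈w , fold≈ , len , split = w , x ∷ ws , y≈w , trans (∙-congˡ fold≈) (swap x w (fold ws)) , Eq.cong suc len , split′
    where
    swap : ∀ a b c → a ∙ (b ∙ c) ≈ b ∙ (a ∙ c)
    swap a b c = trans (sym (assoc a b c)) (trans (∙-congʳ (comm a b)) (assoc b a c))
    split′ : ∀ {z} → Any (z ≈_) (x ∷ xs) → z ≈ w ⊎ Any (z ≈_) (x ∷ ws)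
    split′ (here z≈x) = inj₂ (here z≈x)
    split′ (there z∈xs) with split z∈xs
    ... | inj₁ z≈w  = inj₁ z≈w
    ... | inj₂ z∈ws = inj₂ (there z∈ws)

  fold-rearrange : ∀ xs ys → length xs ≡ length ys → AllPairs (λ a b → ¬ (a ≈ b)) ys →
    All (λ y → Any (y ≈_) xs) ys → fold xs ≈ fold ys
  fold-rearrange []       []       _  _ _ = refl
  fold-rearrange (x ∷ xs) []       () _ _
  fold-rearrange xs (y ∷ ys) len (y∉ys ∷ distinct) (y∈xs ∷ ys⊆xs) with remove y∈xs
  ... | w , ws , y≈w , fold≈ , len′ , split =
    trans fold≈ (∙-cong (sym y≈w) (fold-rearrange ws ys (Eq.cong ℕ.pred (Eq.trans (Eq.sym len′) len)) distinct (shrink y∉ys ys⊆xs)))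
    where
    shrink : ∀ {zs} → All (λ z → ¬ (y ≈ z)) zs → All (λ z → Any (z ≈_) xs) zs → All (λ z → Any (z ≈_) ws) zs
    shrink []           []            = []
    shrink (y≉z ∷ y≉zs) (z∈xs ∷ zs∈xs) with split z∈xs
    ... | inj₁ z≈w  = ⊥-elim (y≉z (trans y≈w (sym z≈w)))
    ... | inj₂ z∈ws = z∈ws ∷ shrink y≉zs zs∈xs

module FieldFacts (K : FField) (q : ℕ) (τ : FField.Carrier K) where
  open FField K public
  open Geometry K q τ public
  open import Relation.Binary.Reasoning.Setoid setoid public
  open IntegerRingSolver commRing public using (solve; _:=_; _:+_; _:*_; :-_; _:-_; nat)
  open import Algebra.Properties.Group +-group using (x∙y⁻¹≈ε⇒x≈y; x≈y⇒x∙y⁻¹≈ε)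
  open import Algebra.Properties.Ring ring public using (-0#≈0#; -‿involutive; -‿distribʳ-*; -1*x≈-x)

  diff≈0⇒≈ : ∀ {x y} → x + - y ≈ 0# → x ≈ y
  diff≈0⇒≈ = x∙y⁻¹≈ε⇒x≈y _ _

  ≈⇒diff≈0 : ∀ {x y} → x ≈ y → x + - y ≈ 0#
  ≈⇒diff≈0 = x≈y⇒x∙y⁻¹≈ε

  inverseˡ : ∀ x → ¬ (x ≈ 0#) → (x ⁻¹) * x ≈ 1#
  inverseˡ x x≉0 = trans (*-comm _ _) (⁻¹-inv x x≉0)

  cancel-nonzero : ∀ {x y} → ¬ (x ≈ 0#) → x * y ≈ 0# → y ≈ 0#
  cancel-nonzero {x} {y} x≉0 xy≈0 = begin
    y                 ≈⟨ sym (*-identityˡ y) ⟩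
    1# * y            ≈⟨ *-congʳ (sym (inverseˡ x x≉0)) ⟩
    ((x ⁻¹) * x) * y  ≈⟨ *-assoc _ _ _ ⟩
    (x ⁻¹) * (x * y)  ≈⟨ *-congˡ xy≈0 ⟩
    (x ⁻¹) * 0#       ≈⟨ zeroʳ _ ⟩
    0#                ∎

  *-nonzero : ∀ {x y} → ¬ (x ≈ 0#) → ¬ (y ≈ 0#) → ¬ (x * y ≈ 0#)
  *-nonzero x≉0 y≉0 xy≈0 = y≉0 (cancel-nonzero x≉0 xy≈0)

  inverse-unique : ∀ {x y} → x * y ≈ 1# → y ≈ x ⁻¹
  inverse-unique {x} {y} xy≈1 = begin
    y                 ≈⟨ sym (*-identityˡ y) ⟩
    1# * y            ≈⟨ *-congʳ (sym (inverseˡ x x≉0)) ⟩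
    ((x ⁻¹) * x) * y  ≈⟨ *-assoc _ _ _ ⟩
    (x ⁻¹) * (x * y)  ≈⟨ *-congˡ xy≈1 ⟩
    (x ⁻¹) * 1#       ≈⟨ *-identityʳ _ ⟩
    x ⁻¹              ∎
    where
    x≉0 : ¬ (x ≈ 0#)
    x≉0 x≈0 = 0≉1 (trans (sym (trans (*-congʳ x≈0) (zeroˡ y))) xy≈1)

  ⁻¹-cong : ∀ {x y} → ¬ (x ≈ 0#) → x ≈ y → x ⁻¹ ≈ y ⁻¹
  ⁻¹-cong {x} x≉0 x≈y = inverse-unique (trans (*-congʳ (sym x≈y)) (⁻¹-inv x x≉0))

  divide-multiply : ∀ x {y} → ¬ (y ≈ 0#) → (x * y ⁻¹) * y ≈ x
  divide-multiply x {y} y≉0 = trans (*-assoc _ _ _) (trans (*-congˡ (inverseˡ y y≉0)) (*-identityʳ x))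

  -- The power function of Defs is not the library's, so its laws are proved here.
  ^-cong : ∀ {x y} n → x ≈ y → x ^ n ≈ y ^ n
  ^-cong zero    _   = refl
  ^-cong (suc n) x≈y = *-cong x≈y (^-cong n x≈y)

  ^-+ : ∀ x m n → x ^ (m ℕ.+ n) ≈ x ^ m * x ^ n
  ^-+ x zero    n = sym (*-identityˡ _)
  ^-+ x (suc m) n = trans (*-congˡ (^-+ x m n)) (sym (*-assoc _ _ _))

  ^-* : ∀ x m n → x ^ (m ℕ.* n) ≈ (x ^ m) ^ n
  ^-* x m n = trans (reflexive (Eq.cong (x ^_) (ℕP.*-comm m n))) (^-*ʳ n)
    where
    ^-*ʳ : ∀ k → x ^ (k ℕ.* m) ≈ (x ^ m) ^ k
    ^-*ʳ zero    = refl
    ^-*ʳ (suc k) = trans (^-+ x m (k ℕ.* m)) (*-congˡ (^-*ʳ k))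

  *-^ : ∀ x y n → (x * y) ^ n ≈ x ^ n * y ^ n
  *-^ x y zero    = sym (*-identityˡ _)
  *-^ x y (suc n) = trans (*-congˡ (*-^ x y n))
    (solve 4 (λ x y a b → x :* y :* (a :* b) := (x :* a) :* (y :* b)) refl x y (x ^ n) (y ^ n))

  1^ : ∀ n → 1# ^ n ≈ 1#
  1^ zero    = refl
  1^ (suc n) = trans (*-identityˡ _) (1^ n)

  0^ : ∀ n → ¬ (n ≡ 0) → 0# ^ n ≈ 0#
  0^ zero    n≢0 = ⊥-elim (n≢0 Eq.refl)
  0^ (suc n) _   = zeroˡ _

  ^-nonzero : ∀ {x} n → ¬ (x ≈ 0#) → ¬ (x ^ n ≈ 0#)
  ^-nonzero zero    _   1≈0 = 0≉1 (sym 1≈0)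
  ^-nonzero (suc n) x≉0     = *-nonzero x≉0 (^-nonzero n x≉0)

  -- Polynomials as coefficient lists, constant term first.  A monic
  -- polynomial with n + 1 coefficients has at most n distinct roots.
  module Polynomial where

    eval : List Carrier → Carrier → Carrier
    eval []       x = 0#
    eval (c ∷ cs) x = c + x * eval cs x

    Monic : List Carrier → Set
    Monic []            = ⊥
    Monic (c ∷ [])      = c ≈ 1#
    Monic (c ∷ c′ ∷ cs) = Monic (c′ ∷ cs)

    quotient : Carrier → List Carrier → List Carrier
    quotient r []            = []
    quotient r (c ∷ [])      = []
    quotient r (c ∷ c′ ∷ cs) = eval (c′ ∷ cs) r ∷ quotient r (c′ ∷ cs)

    eval-constant : ∀ c x → eval (c ∷ []) x ≈ c
    eval-constant c x = trans (+-congˡ (zeroʳ x)) (+-identityʳ c)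

    division : ∀ r P x → eval P x ≈ (x + - r) * eval (quotient r P) x + eval P r
    division r []            x = sym (trans (+-congʳ (zeroʳ _)) (+-identityʳ 0#))
    division r (c ∷ [])      x = trans (eval-constant c x) (sym (trans (+-cong (zeroʳ _) (eval-constant c r)) (+-identityˡ c)))
    division r (c ∷ c′ ∷ cs) x = trans (+-congˡ (*-congˡ (division r (c′ ∷ cs) x)))
      (solve 5 (λ c x r Q E → c :+ x :* ((x :- r) :* Q :+ E) := (x :- r) :* (E :+ x :* Q) :+ (c :+ r :* E)) refl
        c x r (eval (quotient r (c′ ∷ cs)) x) (eval (c′ ∷ cs) r))

    quotient-monic : ∀ r c c′ cs → Monic (c ∷ c′ ∷ cs) → Monic (quotient r (c ∷ c′ ∷ cs))
    quotient-monic r c c′ []         monic = trans (eval-constant c′ r) monic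
    quotient-monic r c c′ (c″ ∷ cs)  monic = quotient-monic r c′ c″ cs monic

    quotient-length : ∀ r c cs → length (quotient r (c ∷ cs)) ≡ length cs
    quotient-length r c []        = Eq.refl
    quotient-length r c (c′ ∷ cs) = Eq.cong suc (quotient-length r c′ cs)

    root-bound : ∀ P → Monic P → ∀ rs → AllPairs (λ a b → ¬ (a ≈ b)) rs →
      All (λ r → eval P r ≈ 0#) rs → length rs ℕ.< length P
    root-bound (c ∷ cs)      monic []       _                _           = ℕ.s≤s ℕ.z≤n
    root-bound (c ∷ [])      monic (r ∷ rs) _                (root ∷ _)  = ⊥-elim (0≉1 (trans (sym root) (trans (eval-constant c r) monic)))
    root-bound (c ∷ c′ ∷ cs) monic (r ∷ rs) (r∉rs ∷ distinct) (root ∷ roots) =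
      ℕ.s≤s (Eq.subst (length rs ℕ.<_) (quotient-length r c (c′ ∷ cs))
        (root-bound (quotient r P) (quotient-monic r c c′ cs monic) rs distinct (roots-of-quotient rs r∉rs roots)))
      where
      P = c ∷ c′ ∷ cs
      roots-of-quotient : ∀ ss → All (λ s → ¬ (r ≈ s)) ss → All (λ s → eval P s ≈ 0#) ss → All (λ s → eval (quotient r P) s ≈ 0#) ss
      roots-of-quotient []       []           []            = []
      roots-of-quotient (s ∷ ss) (r≉s ∷ r≉ss) (Ps≈0 ∷ Pss≈0) =
        cancel-nonzero (λ s-r≈0 → r≉s (sym (diff≈0⇒≈ s-r≈0))) product≈0 ∷ roots-of-quotient ss r≉ss Pss≈0
        where
        D = (s + - r) * eval (quotient r P) s
        product≈0 : D ≈ 0#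
        product≈0 = begin
          D                             ≈⟨ solve 2 (λ a b → a := (a :+ b) :- b) refl D (eval P r) ⟩
          (D + eval P r) + - eval P r   ≈⟨ +-congʳ (sym (division r P s)) ⟩
          eval P s + - eval P r         ≈⟨ +-cong Ps≈0 (-‿cong root) ⟩
          0# + - 0#                     ≈⟨ -‿inverseʳ 0# ⟩
          0#                            ∎

    monomial : ℕ → List Carrier
    monomial zero    = 1# ∷ []
    monomial (suc n) = 0# ∷ monomial n

    eval-monomial : ∀ n x → eval (monomial n) x ≈ x ^ n
    eval-monomial zero    x = eval-constant 1# x
    eval-monomial (suc n) x = trans (+-congˡ (*-congˡ (eval-monomial n x))) (+-identityˡ _)

    monomial-monic : ∀ n → Monic (monomial n)
    monomial-monic zero          = refl
    monomial-monic (suc zero)    = refl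
    monomial-monic (suc (suc n)) = monomial-monic (suc n)

    monomial-length : ∀ n → length (monomial n) ≡ suc n
    monomial-length zero    = Eq.refl
    monomial-length (suc n) = Eq.cong suc (monomial-length n)

    power-minus-x : ℕ → List Carrier
    power-minus-x e = 0# ∷ (- 1#) ∷ monomial e

    power-minus-x-monic : ∀ e → Monic (power-minus-x e)
    power-minus-x-monic zero    = refl
    power-minus-x-monic (suc e) = monomial-monic (suc e)

    eval-power-minus-x : ∀ e x → eval (power-minus-x e) x ≈ x ^ suc (suc e) + - x
    eval-power-minus-x e x = trans (+-identityˡ _) (trans (*-congˡ (+-congˡ (*-congˡ (eval-monomial e x))))
      (trans (solve 3 (λ x o m → x :* (:- o :+ x :* m) := x :* (x :* m) :- x :* o) refl x 1# (x ^ e))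
        (+-congˡ (-‿cong (*-identityʳ x)))))

  not-all-roots : ∀ n → 1 ℕ.< n → (elems : List Carrier) → AllPairs (λ a b → ¬ (a ≈ b)) elems → n ℕ.< length elems →
    ¬ (∀ x → x ^ n ≈ x)
  not-all-roots (suc zero)    (ℕ.s≤s ())
  not-all-roots (suc (suc e)) _ elems distinct n<|K| all-roots =
    ℕP.<⇒≱ n<|K| (ℕP.≤-pred (Eq.subst (length elems ℕ.<_) length≡ bound))
    where
    open Polynomial
    roots : ∀ xs → All (λ r → eval (power-minus-x e) r ≈ 0#) xs
    roots []       = []
    roots (x ∷ xs) = trans (eval-power-minus-x e x) (≈⇒diff≈0 (all-roots x)) ∷ roots xs
    bound : length elems ℕ.< length (power-minus-x e)
    bound = root-bound (power-minus-x e) (power-minus-x-monic e) elems distinct (roots elems)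
    length≡ : length (power-minus-x e) ≡ suc (suc (suc e))
    length≡ = Eq.cong (λ n → suc (suc n)) (monomial-length e)

module FiniteField (K : FField) (q : ℕ) (τ : FField.Carrier K) (N : ℕ) (order : HasOrder K N) where
  open FieldFacts K q τ public
  import Data.List.Relation.Unary.AllPairs as AllPairs
  import Data.List.Relation.Unary.AllPairs.Properties as AllPairsₚ
  open import Data.List.Properties using (length-map)

  elements : List Carrier
  elements = proj₁ order

  complete : (x : Carrier) → Any (x ≈_) elements
  complete = proj₁ (proj₂ order)

  distinct : AllPairs (λ x y → ¬ (x ≈ y)) elements
  distinct = proj₁ (proj₂ (proj₂ order))

  length≡N : length elements ≡ N
  length≡N = proj₂ (proj₂ (proj₂ order))

  _≟_ : ∀ x y → Dec (x ≈ y)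
  x ≟ y = compare distinct (complete x) (complete y)
    where
    compare : ∀ {x y} {xs : List Carrier} → AllPairs (λ x y → ¬ (x ≈ y)) xs → Any (x ≈_) xs → Any (y ≈_) xs → Dec (x ≈ y)
    compare (_ ∷ _)     (here x≈a) (here y≈a) = yes (trans x≈a (sym y≈a))
    compare (a≉ ∷ _)    (here x≈a) (there y∈) = no (λ x≈y → proj₁ w (trans (sym x≈a) (trans x≈y (proj₂ w))))
      where w = lookupAny a≉ y∈
    compare (a≉ ∷ _)    (there x∈) (here y≈a) = no (λ x≈y → proj₁ w (trans (sym y≈a) (trans (sym x≈y) (proj₂ w))))
      where w = lookupAny a≉ x∈
    compare (_ ∷ pairs) (there x∈) (there y∈) = compare pairs x∈ y∈

  zero-product : ∀ {x y} → x * y ≈ 0# → x ≈ 0# ⊎ y ≈ 0#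
  zero-product {x} xy≈0 with x ≟ 0#
  ... | yes x≈0 = inj₁ x≈0
  ... | no  x≉0 = inj₂ (cancel-nonzero x≉0 xy≈0)

  -- Summing all elements before and after the shift x ↦ x + 1 shows N·1 = 0.
  N·1≈0 : nat N ≈ 0#
  N·1≈0 = begin
    nat N                         ≈⟨ solve 2 (λ a n → n := (a :+ n) :- a) refl (Sum.fold elements) (nat N) ⟩
    (Sum.fold elements + nat N) + - Sum.fold elements ≈⟨ +-congʳ (sym shifted) ⟩
    Sum.fold elements + - Sum.fold elements ≈⟨ -‿inverseʳ _ ⟩
    0#                            ∎
    where
    module Sum = RearrangedFold +-commutativeMonoid
    open import Algebra.Properties.Monoid.Mult +-monoid using (×-homo-+)
    shift : ∀ xs → Sum.fold (map (λ x → x + 1#) xs) ≈ Sum.fold xs + nat (length xs)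
    shift []       = sym (+-identityʳ 0#)
    shift (x ∷ xs) = trans (+-congˡ (shift xs))
      (solve 4 (λ x o f n → (x :+ o) :+ (f :+ n) := (x :+ f) :+ (o :+ n)) refl x 1# (Sum.fold xs) (nat (length xs)))
    cancel-+1 : ∀ {a b} → a + 1# ≈ b + 1# → a ≈ b
    cancel-+1 {a} {b} e = trans (solve 2 (λ a c → a := (a :+ c) :- c) refl a 1#)
                               (trans (+-congʳ e) (solve 2 (λ b c → (b :+ c) :- c := b) refl b 1#))
    shifted-elements = map (λ x → x + 1#) elements
    shifted : Sum.fold elements ≈ Sum.fold elements + nat N
    shifted = trans (Sum.fold-rearrange elements shifted-elements (Eq.sym (length-map _ elements))
                      (AllPairsₚ.map⁺ (AllPairs.map (λ a≉b e → a≉b (cancel-+1 e)) distinct)) (all-complete shifted-elements))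
                (trans (shift elements) (+-congˡ (reflexive (Eq.cong nat length≡N))))
      where
      all-complete : ∀ xs → All (λ y → Any (y ≈_) elements) xs
      all-complete []       = []
      all-complete (x ∷ xs) = complete x ∷ all-complete xs

  nat-^ : ∀ m n → nat (m ℕ.^ n) ≈ nat m ^ n
  nat-^ m zero    = +-identityʳ 1#
  nat-^ m (suc n) = trans (×1-homo-* m (m ℕ.^ n)) (*-congˡ (nat-^ m n))
    where open import Algebra.Properties.Semiring.Mult semiring using (×1-homo-*)

  characteristic : ∀ p k → N ≡ p ℕ.^ suc k → nat p ≈ 0#
  characteristic p k N≡ with nat p ≟ 0#
  ... | yes p·1≈0 = p·1≈0
  ... | no  p·1≉0 = ⊥-elim (^-nonzero (suc k) p·1≉0
                      (trans (sym (nat-^ p (suc k))) (trans (reflexive (Eq.cong nat (Eq.sym N≡))) N·1≈0)))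

  -- In characteristic p the binomial expansion of (x + y)ᵖ collapses.
  frobenius-+ : ∀ p → Prime p → nat p ≈ 0# → ∀ x y → (x + y) ^ p ≈ x ^ p + y ^ p
  frobenius-+ zero    p-prime _ x y = ⊥-elim (ℕP.n≮0 (PrimeBinomial.prime>1 p-prime))
  frobenius-+ (suc p′) p-prime p·1≈0 x y = begin
    (x + y) ^ p                  ≈⟨ sym (^≈^ₛ (x + y) p) ⟩
    (x + y) ^ₛ p                 ≈⟨ Binomial.theorem p x y ⟩
    Binomial.binomialExpansion x y p ≈⟨ +-congˡ (sum-last p′ (tail term) middle-terms-vanish) ⟩
    term Fin.zero + term (fromℕ p) ≈⟨ +-cong first-term last-term ⟩
    y ^ p + x ^ p                ≈⟨ +-comm _ _ ⟩
    x ^ p + y ^ p                ∎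
    where
    open import Algebra.Properties.Semiring.Exp semiring using () renaming (_^_ to _^ₛ_)
    import Algebra.Properties.CommutativeSemiring.Binomial commutativeSemiring as Binomial
    open import Algebra.Properties.Semiring.Sum semiring using (sum)
    open import Algebra.Properties.Semiring.Mult semiring using (×1-homo-*; ×-assoc-*) renaming (_×_ to _·_)
    open import Algebra.Properties.Monoid.Mult +-monoid using (×-congʳ)
    open import Data.Nat.Combinatorics using (_C_; nCn≡1)
    open import Data.Nat.Divisibility using (divides)
    open import Data.Fin as Fin using (Fin; toℕ; fromℕ)
    import Data.Fin.Properties as Finₚ
    open import Data.Vec.Functional using (Vector; tail)
    p = suc p′
    term = Binomial.binomialTerm x y p

    ^≈^ₛ : ∀ z n → z ^ₛ n ≈ z ^ n
    ^≈^ₛ z zero    = refl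
    ^≈^ₛ z (suc n) = *-congˡ (^≈^ₛ z n)

    ·≈nat* : ∀ n z → n · z ≈ nat n * z
    ·≈nat* n z = trans (×-congʳ n (sym (*-identityˡ z))) (sym (×-assoc-* n 1# z))

    sum-last : ∀ m (u : Vector Carrier (suc m)) → (∀ i → toℕ i Eq.≢ m → u i ≈ 0#) → sum u ≈ u (fromℕ m)
    sum-last zero    u others≈0 = +-identityʳ _
    sum-last (suc m) u others≈0 =
      trans (+-cong (others≈0 Fin.zero (λ ())) (sum-last m (tail u) (λ i i≢m → others≈0 (Fin.suc i) (λ e → i≢m (ℕP.suc-injective e)))))
            (+-identityˡ _)

    middle-terms-vanish : ∀ i → toℕ i Eq.≢ p′ → tail term i ≈ 0#
    middle-terms-vanish i i≢p′
      with PrimeBinomial.prime-∣-binomial p-prime (suc (toℕ i)) (ℕ.s≤s ℕ.z≤n)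
             (ℕ.s≤s (ℕP.≤∧≢⇒< (ℕP.≤-pred (Finₚ.toℕ<n i)) i≢p′))
    ... | divides d p∣C = begin
      tail term i                    ≈⟨ ·≈nat* (p C suc (toℕ i)) b ⟩
      nat (p C suc (toℕ i)) * b      ≈⟨ *-congʳ (trans (reflexive (Eq.cong nat p∣C)) (×1-homo-* d p)) ⟩
      (nat d * nat p) * b            ≈⟨ *-congʳ (trans (*-congˡ p·1≈0) (zeroʳ _)) ⟩
      0# * b                         ≈⟨ zeroˡ _ ⟩
      0#                             ∎
      where b = Binomial.binomial x y p (Fin.suc i)

    first-term : term Fin.zero ≈ y ^ p
    first-term = trans (·≈nat* 1 _) (trans (*-congʳ (+-identityʳ 1#)) (trans (*-identityˡ _) (trans (*-identityˡ _) (^≈^ₛ y p))))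

    last-term : term (fromℕ p) ≈ x ^ p
    last-term = trans (·≈nat* (p C toℕ (fromℕ p)) _)
      (Eq.subst (λ k → nat (p C k) * (x ^ₛ k * y ^ₛ (p ∸ k)) ≈ x ^ p) (Eq.sym (Finₚ.toℕ-fromℕ p))
        (trans (*-congʳ (trans (reflexive (Eq.cong nat (nCn≡1 p))) (+-identityʳ 1#))) (trans (*-identityˡ _)
          (trans (*-congˡ (reflexive (Eq.cong (y ^ₛ_) (ℕP.n∸n≡0 p)))) (trans (*-identityʳ _) (^≈^ₛ x p))))))

  -- Fermat: multiplying all nonzero elements by a ≠ 0 permutes them, so
  -- a^(N−1) = 1 for a ≠ 0, and xᴺ = x for every x.
  module NonzeroElements where
    nonzero : List Carrier → List Carrier
    nonzero []       = []
    nonzero (x ∷ xs) with x ≟ 0#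
    ... | yes _ = nonzero xs
    ... | no  _ = x ∷ nonzero xs

    Nonzero : Carrier → Set
    Nonzero x = ¬ (x ≈ 0#)

    nonzero-all : ∀ xs → All Nonzero (nonzero xs)
    nonzero-all []       = []
    nonzero-all (x ∷ xs) with x ≟ 0#
    ... | yes _   = nonzero-all xs
    ... | no  x≉0 = x≉0 ∷ nonzero-all xs

    nonzero-complete : ∀ {z} xs → Any (z ≈_) xs → Nonzero z → Any (z ≈_) (nonzero xs)
    nonzero-complete (x ∷ xs) z∈ z≉0 with x ≟ 0#
    nonzero-complete (x ∷ xs) (here z≈x) z≉0 | yes x≈0 = ⊥-elim (z≉0 (trans z≈x x≈0))
    nonzero-complete (x ∷ xs) (there z∈) z≉0 | yes _   = nonzero-complete xs z∈ z≉0
    nonzero-complete (x ∷ xs) (here z≈x) z≉0 | no  _   = here z≈x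
    nonzero-complete (x ∷ xs) (there z∈) z≉0 | no  _   = there (nonzero-complete xs z∈ z≉0)

    nonzero-distinct : ∀ xs → AllPairs (λ a b → ¬ (a ≈ b)) xs → AllPairs (λ a b → ¬ (a ≈ b)) (nonzero xs)
    nonzero-distinct []       []             = []
    nonzero-distinct (x ∷ xs) (x∉ ∷ pairs) with x ≟ 0#
    ... | yes _ = nonzero-distinct xs pairs
    ... | no  _ = sublist xs x∉ ∷ nonzero-distinct xs pairs
      where
      sublist : ∀ {x} ys → All (λ y → ¬ (x ≈ y)) ys → All (λ y → ¬ (x ≈ y)) (nonzero ys)
      sublist []       []         = []
      sublist (z ∷ zs) (x≉z ∷ ps) with z ≟ 0#
      ... | yes _ = sublist zs ps
      ... | no  _ = x≉z ∷ sublist zs ps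

    nonzero-length : ∀ xs → AllPairs (λ a b → ¬ (a ≈ b)) xs → Any (0# ≈_) xs → suc (length (nonzero xs)) ≡ length xs
    nonzero-length (x ∷ xs) (x∉ ∷ pairs) 0∈ with x ≟ 0#
    nonzero-length (x ∷ xs) (x∉ ∷ pairs) 0∈         | yes x≈0 = Eq.cong suc (keep-all xs (others x∉ x≈0))
      where
      others : ∀ {ys} → All (λ y → ¬ (x ≈ y)) ys → x ≈ 0# → All Nonzero ys
      others []         _   = []
      others (x≉y ∷ ps) x≈0 = (λ y≈0 → x≉y (trans x≈0 (sym y≈0))) ∷ others ps x≈0
      keep-all : ∀ ys → All Nonzero ys → length (nonzero ys) ≡ length ys
      keep-all []       []         = Eq.refl
      keep-all (y ∷ ys) (y≉0 ∷ ps) with y ≟ 0#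
      ... | yes y≈0 = ⊥-elim (y≉0 y≈0)
      ... | no  _   = Eq.cong suc (keep-all ys ps)
    nonzero-length (x ∷ xs) (x∉ ∷ pairs) (here 0≈x)  | no  x≉0 = ⊥-elim (x≉0 (sym 0≈x))
    nonzero-length (x ∷ xs) (x∉ ∷ pairs) (there 0∈) | no  _   = Eq.cong suc (nonzero-length xs pairs 0∈)

  fermat : ∀ x → x ^ N ≈ x
  fermat x = Eq.subst (λ n → x ^ n ≈ x) (Eq.trans (nonzero-length elements distinct (complete 0#)) length≡N) x^[1+n]≈x
    where
    open NonzeroElements
    module Π = RearrangedFold *-commutativeMonoid
    units = nonzero elements

    scale : ∀ a xs → Π.fold (map (a *_) xs) ≈ a ^ length xs * Π.fold xs
    scale a []       = sym (*-identityʳ 1#)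
    scale a (x ∷ xs) = trans (*-congˡ (scale a xs))
      (solve 4 (λ a x b f → (a :* x) :* (b :* f) := (a :* b) :* (x :* f)) refl a x (a ^ length xs) (Π.fold xs))

    product-nonzero : ∀ xs → All Nonzero xs → Nonzero (Π.fold xs)
    product-nonzero []       []         1≈0 = 0≉1 (sym 1≈0)
    product-nonzero (x ∷ xs) (x≉0 ∷ ps)     = *-nonzero x≉0 (product-nonzero xs ps)

    lagrange : ∀ a → Nonzero a → a ^ length units ≈ 1#
    lagrange a a≉0 = cancel (product-nonzero units (nonzero-all elements)) product≈
      where
      a*-injective : ∀ {x y} → a * x ≈ a * y → x ≈ y
      a*-injective {x} {y} e = diff≈0⇒≈ (cancel-nonzero a≉0
        (trans (solve 3 (λ a x y → a :* (x :- y) := a :* x :- a :* y) refl a x y) (≈⇒diff≈0 e)))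
      scaled-units : ∀ xs → All Nonzero xs → All (λ y → Any (y ≈_) units) (map (a *_) xs)
      scaled-units []       []         = []
      scaled-units (x ∷ xs) (x≉0 ∷ ps) = nonzero-complete elements (complete (a * x)) (*-nonzero a≉0 x≉0) ∷ scaled-units xs ps
      product≈ : Π.fold units ≈ a ^ length units * Π.fold units
      product≈ = trans (Π.fold-rearrange units (map (a *_) units) (Eq.sym (length-map _ units))
                         (AllPairsₚ.map⁺ (AllPairs.map (λ x≉y e → x≉y (a*-injective e)) (nonzero-distinct elements distinct)))
                         (scaled-units units (nonzero-all elements)))
                       (scale a units)
      cancel : ∀ {f c} → Nonzero f → f ≈ c * f → c ≈ 1#
      cancel {f} {c} f≉0 f≈cf = diff≈0⇒≈ (cancel-nonzero f≉0
        (trans (solve 3 (λ f c o → f :* (c :- o) := c :* f :- f :* o) refl f c 1#)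
               (trans (+-congˡ (-‿cong (*-identityʳ f))) (≈⇒diff≈0 (sym f≈cf)))))

    x^[1+n]≈x : x ^ suc (length units) ≈ x
    x^[1+n]≈x with x ≟ 0#
    ... | yes x≈0 = trans (*-congʳ x≈0) (trans (zeroˡ _) (sym x≈0))
    ... | no  x≉0 = trans (*-congˡ (lagrange x x≉0)) (*-identityʳ x)

module PrimePowerField (K : FField) (q : ℕ) (τ : FField.Carrier K) (prime-power : IsPrimePower q)
                       (order : HasOrder K (q ℕ.^ 4)) where
  open FiniteField K q τ (q ℕ.^ 4) order public

  private
    p : ℕ
    p = proj₁ prime-power
    h : ℕ
    h = proj₁ (proj₂ prime-power)
    p-prime : Prime p
    p-prime = proj₁ (proj₂ (proj₂ prime-power))
    q≡pʰ⁺¹ : q ≡ p ℕ.^ suc h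
    q≡pʰ⁺¹ = proj₂ (proj₂ (proj₂ prime-power))

  Additive : ℕ → Set
  Additive e = ∀ x y → (x + y) ^ e ≈ x ^ e + y ^ e

  additive-q^ : ∀ k → Additive (q ℕ.^ k)
  additive-q^ k = Eq.subst Additive (Eq.sym (Eq.trans (Eq.cong (ℕ._^ k) q≡pʰ⁺¹) (ℕP.^-*-assoc p (suc h) k)))
                    (additive-p^ (suc h ℕ.* k))
    where
    additive-p : Additive p
    additive-p = frobenius-+ p p-prime (characteristic p (3 ℕ.+ h ℕ.* 4)
                   (Eq.trans (Eq.cong (ℕ._^ 4) q≡pʰ⁺¹) (ℕP.^-*-assoc p (suc h) 4)))
    additive-p^ : ∀ n → Additive (p ℕ.^ n)
    additive-p^ zero    x y = trans (*-identityʳ _) (+-cong (sym (*-identityʳ x)) (sym (*-identityʳ y)))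
    additive-p^ (suc n) x y = begin
      (x + y) ^ (p ℕ.* p ℕ.^ n)               ≈⟨ ^-* (x + y) p (p ℕ.^ n) ⟩
      ((x + y) ^ p) ^ (p ℕ.^ n)               ≈⟨ ^-cong (p ℕ.^ n) (additive-p x y) ⟩
      (x ^ p + y ^ p) ^ (p ℕ.^ n)             ≈⟨ additive-p^ n _ _ ⟩
      (x ^ p) ^ (p ℕ.^ n) + (y ^ p) ^ (p ℕ.^ n) ≈⟨ sym (+-cong (^-* x p (p ℕ.^ n)) (^-* y p (p ℕ.^ n))) ⟩
      x ^ (p ℕ.* p ℕ.^ n) + y ^ (p ℕ.* p ℕ.^ n) ∎

  1<q : 1 ℕ.< q
  1<q = Eq.subst (1 ℕ.<_) (Eq.sym q≡pʰ⁺¹) (ℕP.^-monoʳ-< p (PrimeBinomial.prime>1 p-prime) {0} {suc h} (ℕ.s≤s ℕ.z≤n))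

  q^k≢0 : ∀ k → ¬ (q ℕ.^ k ≡ 0)
  q^k≢0 k = ℕP.n>0⇒n≢0 (ℕP.m^n>0 q {{ℕ.>-nonZero (ℕP.<-trans (ℕ.s≤s ℕ.z≤n) 1<q)}} k)

  module PowerEndomorphism (e : ℕ) (additive : Additive e) (e≢0 : ¬ (e ≡ 0)) where
    hom-+ : ∀ x y → (x + y) ^ e ≈ x ^ e + y ^ e
    hom-+ = additive
    hom-* : ∀ x y → (x * y) ^ e ≈ x ^ e * y ^ e
    hom-* x y = *-^ x y e
    hom-cong : ∀ {x y} → x ≈ y → x ^ e ≈ y ^ e
    hom-cong = ^-cong e
    hom-1 : 1# ^ e ≈ 1#
    hom-1 = 1^ e
    hom-0 : 0# ^ e ≈ 0#
    hom-0 = 0^ e e≢0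
    hom-neg : ∀ x → (- x) ^ e ≈ - (x ^ e)
    hom-neg x = begin
      (- x) ^ e                        ≈⟨ solve 2 (λ a b → a := (b :+ a) :- b) refl ((- x) ^ e) (x ^ e) ⟩
      (x ^ e + (- x) ^ e) + - (x ^ e)  ≈⟨ +-congʳ (sym (additive x (- x))) ⟩
      (x + - x) ^ e + - (x ^ e)        ≈⟨ +-congʳ (trans (hom-cong (-‿inverseʳ x)) hom-0) ⟩
      0# + - (x ^ e)                   ≈⟨ +-identityˡ _ ⟩
      - (x ^ e)                        ∎
    hom-nonzero : ∀ {x} → ¬ (x ≈ 0#) → ¬ (x ^ e ≈ 0#)
    hom-nonzero = ^-nonzero e
    hom-⁻¹ : ∀ {x} → ¬ (x ≈ 0#) → (x ⁻¹) ^ e ≈ (x ^ e) ⁻¹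
    hom-⁻¹ {x} x≉0 = inverse-unique (trans (sym (hom-* x (x ⁻¹))) (trans (hom-cong (⁻¹-inv x x≉0)) hom-1))

  Φ : ℕ → Carrier → Carrier
  Φ k x = x ^ (q ℕ.^ k)

  module Φ (k : ℕ) = PowerEndomorphism (q ℕ.^ k) (additive-q^ k) (q^k≢0 k)

  φ : Carrier → Carrier
  φ x = x ^ q

  module φ = PowerEndomorphism q (Eq.subst Additive (ℕP.*-identityʳ q) (additive-q^ 1))
                                 (Eq.subst (λ n → ¬ (n ≡ 0)) (ℕP.*-identityʳ q) (q^k≢0 1))

  φ≈Φ1 : ∀ x → φ x ≈ Φ 1 x
  φ≈Φ1 x = reflexive (Eq.cong (x ^_) (Eq.sym (ℕP.*-identityʳ q)))

  Φ-∘ : ∀ a b x → Φ a (Φ b x) ≈ Φ (b ℕ.+ a) x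
  Φ-∘ a b x = trans (sym (^-* x (q ℕ.^ b) (q ℕ.^ a))) (reflexive (Eq.cong (x ^_) (Eq.sym (ℕP.^-distribˡ-+-* q b a))))

  φ∘φ : ∀ x → φ (φ x) ≈ Φ 2 x
  φ∘φ x = trans (φ.hom-cong (φ≈Φ1 x)) (trans (φ≈Φ1 _) (Φ-∘ 1 1 x))

  Φ-^ : ∀ k x i → Φ k (x ^ i) ≈ Φ k x ^ i
  Φ-^ k x zero    = Φ.hom-1 k
  Φ-^ k x (suc i) = trans (Φ.hom-* k x (x ^ i)) (*-congˡ (Φ-^ k x i))

  InF-+ : ∀ k {x y} → InF k x → InF k y → InF k (x + y)
  InF-+ k x∈ y∈ = trans (Φ.hom-+ k _ _) (+-cong x∈ y∈)
  InF-* : ∀ k {x y} → InF k x → InF k y → InF k (x * y)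
  InF-* k x∈ y∈ = trans (Φ.hom-* k _ _) (*-cong x∈ y∈)
  InF-neg : ∀ k {x} → InF k x → InF k (- x)
  InF-neg k x∈ = trans (Φ.hom-neg k _) (-‿cong x∈)
  InF-⁻¹ : ∀ k {x} → ¬ (x ≈ 0#) → InF k x → InF k (x ⁻¹)
  InF-⁻¹ k x≉0 x∈ = trans (Φ.hom-⁻¹ k x≉0) (⁻¹-cong (Φ.hom-nonzero k x≉0) x∈)
  InF-φ : ∀ k {x} → InF k x → InF k (φ x)
  InF-φ k {x} x∈ = trans (sym (^-* x q (q ℕ.^ k))) (trans (reflexive (Eq.cong (x ^_) (ℕP.*-comm q (q ℕ.^ k))))
                     (trans (^-* x (q ℕ.^ k) q) (φ.hom-cong x∈)))

  F1⇒φ-fixed : ∀ {x} → InF 1 x → φ x ≈ x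
  F1⇒φ-fixed x∈ = trans (φ≈Φ1 _) x∈
  F2⇒φφ-fixed : ∀ {x} → InF 2 x → φ (φ x) ≈ x
  F2⇒φφ-fixed x∈ = trans (φ∘φ _) x∈
  F1⊆F2 : ∀ {x} → InF 1 x → InF 2 x
  F1⊆F2 {x} x∈ = trans (sym (Φ-∘ 1 1 x)) (trans (Φ.hom-cong 1 x∈) x∈)
  F2⊆F4 : ∀ {x} → InF 2 x → InF 4 x
  F2⊆F4 {x} x∈ = trans (sym (Φ-∘ 2 2 x)) (trans (Φ.hom-cong 2 x∈) x∈)

  InF-cong : ∀ k {x y} → x ≈ y → InF k y → InF k x
  InF-cong k {x} {y} x≈y y∈ = trans (^-cong (q ℕ.^ k) x≈y) (trans y∈ (sym x≈y))

  φ⁴-identity : ∀ α → φ (φ (φ (φ α))) ≈ α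
  φ⁴-identity α = trans (φ∘φ _) (trans (Φ.hom-cong 2 (φ∘φ α)) (trans (Φ-∘ 2 2 α) (fermat α)))

  φ-injective-at-0 : ∀ {x} → φ x ≈ 0# → x ≈ 0#
  φ-injective-at-0 {x} φx≈0 with x ≟ 0#
  ... | yes x≈0 = x≈0
  ... | no  x≉0 = ⊥-elim (φ.hom-nonzero x≉0 φx≈0)

  Primitive : Set
  Primitive = (y : Carrier) → InF 2 y → ¬ (y ≈ 0#) → Σ ℕ λ i → y ≈ τ ^ i

  record PrimitiveElement (t0 t1 : Carrier) : Set where
    field
      generates   : Primitive
      τ∈F2        : InF 2 τ
      t0∈F1       : InF 1 t0
      t1∈F1       : InF 1 t1
      τ-quadratic : τ * τ ≈ t1 * τ + t0

  -- If τ ∈ F_q, the powers of τ exhaust F_{q²}, so F_{q²} ⊆ F_q; then every x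
  -- is a root of the quadratic (t − x)(t − Φ 2 x) over F_q, forcing x ∈ F_q,
  -- which contradicts |K| = q⁴ > q.
  primitive⇒δ≉0 : Primitive → ¬ (δ ≈ 0#)
  primitive⇒δ≉0 τ-primitive δ≈0 = not-all-roots q 1<q elements distinct q<|K| (λ x → trans (φ≈Φ1 x) (in-F1 x))
    where
    q<|K| : q ℕ.< length elements
    q<|K| = Eq.subst₂ ℕ._<_ (ℕP.*-identityʳ q) (Eq.sym length≡N) (ℕP.^-monoʳ-< q 1<q {1} {4} (ℕ.s≤s (ℕ.s≤s ℕ.z≤n)))

    τ∈F1 : InF 1 τ
    τ∈F1 = trans (sym (φ≈Φ1 τ)) (sym (diff≈0⇒≈ δ≈0))

    F2⊆F1 : ∀ y → InF 2 y → InF 1 y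
    F2⊆F1 y y∈F2 with y ≟ 0#
    ... | yes y≈0 = trans (Φ.hom-cong 1 y≈0) (trans (Φ.hom-0 1) (sym y≈0))
    ... | no  y≉0 with τ-primitive y y∈F2 y≉0
    ...   | i , y≈τⁱ = trans (Φ.hom-cong 1 y≈τⁱ) (trans (Φ-^ 1 τ i) (trans (^-cong i τ∈F1) (sym y≈τⁱ)))

    in-F1 : ∀ x → InF 1 x
    in-F1 x with zero-product factored
      where
      x̄ = Φ 2 x
      u = Φ 1 x
      x̄̄≈x : Φ 2 x̄ ≈ x
      x̄̄≈x = trans (Φ-∘ 2 2 x) (fermat x)
      -- trace and norm of x over F_{q²} lie in F_q
      s∈F1 : InF 1 (x + x̄)
      s∈F1 = F2⊆F1 _ (trans (Φ.hom-+ 2 x x̄) (trans (+-congˡ x̄̄≈x) (+-comm _ _)))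
      n∈F1 : InF 1 (x * x̄)
      n∈F1 = F2⊆F1 _ (trans (Φ.hom-* 2 x x̄) (trans (*-congˡ x̄̄≈x) (*-comm _ _)))
      x-root : x * x + - ((x + x̄) * x) + x * x̄ ≈ 0#
      x-root = trans (solve 2 (λ x y → x :* x :- (x :+ y) :* x :+ x :* y := x :- x) refl x x̄) (-‿inverseʳ x)
      u-root : u * u + - ((x + x̄) * u) + x * x̄ ≈ 0#
      u-root = begin
        u * u + - ((x + x̄) * u) + x * x̄       ≈⟨ sym (trans (Φ.hom-+ 1 _ _) (+-cong (trans (Φ.hom-+ 1 _ _) (+-cong (Φ.hom-* 1 x x)
                                                      (trans (Φ.hom-neg 1 _) (-‿cong (trans (Φ.hom-* 1 _ x) (*-congʳ s∈F1)))))) n∈F1)) ⟩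
        Φ 1 (x * x + - ((x + x̄) * x) + x * x̄) ≈⟨ Φ.hom-cong 1 x-root ⟩
        Φ 1 0#                                 ≈⟨ Φ.hom-0 1 ⟩
        0#                                     ∎
      factored : (u + - x) * (u + - x̄) ≈ 0#
      factored = trans (solve 3 (λ u x y → (u :- x) :* (u :- y) := u :* u :- (x :+ y) :* u :+ x :* y) refl u x x̄) u-root
    ... | inj₁ u-x≈0 = diff≈0⇒≈ u-x≈0
    ... | inj₂ u-x̄≈0 = sym (trans x≈x̄ (sym u≈x̄))
      where
      u≈x̄ = diff≈0⇒≈ u-x̄≈0
      x̄≈Φ3x : Φ 2 x ≈ Φ 3 x
      x̄≈Φ3x = trans (sym (Φ-∘ 1 1 x)) (trans (Φ.hom-cong 1 u≈x̄) (Φ-∘ 1 2 x))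
      x≈x̄ : x ≈ Φ 2 x
      x≈x̄ = trans (sym (fermat x)) (trans (sym (Φ-∘ 1 3 x)) (trans (Φ.hom-cong 1 (sym x̄≈Φ3x))
               (trans (Φ-∘ 1 2 x) (sym x̄≈Φ3x))))

-- A vector X of PG(4,·) determines the pair
-- (xτ X, yτ X) = (x0 + x1 τ, y0 + y1 τ) and its conjugate (xτq X, yτq X),
-- obtained with τ^q in place of τ.  On Σ∞ the first pair vanishes exactly on
-- the transversal g^q and the second on g, so they locate X relative to the
-- two transversals: X lies on the line joining the point of g over r ∈ ℓ∞
-- and the point of g^q over s ∈ ℓ∞ iff the first pair is a multiple of the
-- representative of r and the second of the representative of s.
module BruckBose (K : FField) (q : ℕ) (τ : FField.Carrier K) (prime-power : IsPrimePower q)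
                 (order : HasOrder K (q ℕ.^ 4)) (t0 t1 : FField.Carrier K)
                 (τ-primitive : PrimePowerField.PrimitiveElement K q τ prime-power order t0 t1) where
  open PrimePowerField K q τ prime-power order public
  open Spread t0 t1 public
  open PrimitiveElement τ-primitive
  open P5

  δ≉0 : ¬ (δ ≈ 0#)
  δ≉0 = primitive⇒δ≉0 generates

  φτq≈τ : φ τq ≈ τ
  φτq≈τ = F2⇒φφ-fixed τ∈F2

  xτ yτ xτq yτq : P5 Carrier → Carrier
  xτ  X = x0 X + x1 X * τ
  yτ  X = y0 X + y1 X * τ
  xτq X = x0 X + x1 X * τq
  yτq X = y0 X + y1 X * τq

  -- the pair (a0 + a1 τ, a0 + a1 τq) determines (a0, a1), because δ ≠ 0
  pair-injective : ∀ {a0 a1 b0 b1} → a0 + a1 * τ ≈ b0 + b1 * τ → a0 + a1 * τq ≈ b0 + b1 * τq → (a0 ≈ b0) × (a1 ≈ b1)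
  pair-injective {a0} {a1} {b0} {b1} eτ eτq = a0≈b0 , a1≈b1
    where
    a1δ : ∀ c0 c1 → c1 * δ ≈ (c0 + c1 * τ) + - (c0 + c1 * τq)
    a1δ c0 c1 = solve 4 (λ c0 c1 t tq → c1 :* (t :- tq) := (c0 :+ c1 :* t) :- (c0 :+ c1 :* tq)) refl c0 c1 τ τq
    a1≈b1 : a1 ≈ b1
    a1≈b1 = diff≈0⇒≈ (cancel-nonzero δ≉0 (trans (solve 3 (λ d a b → d :* (a :- b) := a :* d :- b :* d) refl δ a1 b1)
              (≈⇒diff≈0 (trans (a1δ a0 a1) (trans (+-cong eτ (-‿cong eτq)) (sym (a1δ b0 b1)))))))
    a0≈b0 : a0 ≈ b0
    a0≈b0 = begin
      a0                          ≈⟨ solve 3 (λ a0 a1 t → a0 := (a0 :+ a1 :* t) :- a1 :* t) refl a0 a1 τ ⟩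
      (a0 + a1 * τ) + - (a1 * τ)  ≈⟨ +-cong eτ (-‿cong (*-congʳ a1≈b1)) ⟩
      (b0 + b1 * τ) + - (b1 * τ)  ≈⟨ solve 3 (λ a0 a1 t → (a0 :+ a1 :* t) :- a1 :* t := a0) refl b0 b1 τ ⟩
      b0                          ∎

  coordinates-injective : ∀ {X Y} → xτ X ≈ xτ Y → xτq X ≈ xτq Y → yτ X ≈ yτ Y → yτq X ≈ yτq Y → z X ≈ z Y → X ≈5 Y
  coordinates-injective ex exq ey eyq ez =
    proj₁ (pair-injective ex exq) , proj₂ (pair-injective ex exq) , proj₁ (pair-injective ey eyq) , proj₂ (pair-injective ey eyq) , ez

  linear : ∀ l m u0 u1 v0 v1 t → (l * u0 + m * v0) + (l * u1 + m * v1) * t ≈ l * (u0 + u1 * t) + m * (v0 + v1 * t)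
  linear l m u0 u1 v0 v1 t = solve 7 (λ l m u0 u1 v0 v1 t → (l :* u0 :+ m :* v0) :+ (l :* u1 :+ m :* v1) :* t
      := l :* (u0 :+ u1 :* t) :+ m :* (v0 :+ v1 :* t)) refl l m u0 u1 v0 v1 t

  coordinates-rational : ∀ k → InF k τ → ∀ {X} → Rat5 k X → InF k (xτ X) × InF k (yτ X) × InF k (xτq X) × InF k (yτq X)
  coordinates-rational k τ∈ (x0∈ , x1∈ , y0∈ , y1∈ , _) =
    InF-+ k x0∈ (InF-* k x1∈ τ∈) , InF-+ k y0∈ (InF-* k y1∈ τ∈) ,
    InF-+ k x0∈ (InF-* k x1∈ (InF-φ k τ∈)) , InF-+ k y0∈ (InF-* k y1∈ (InF-φ k τ∈))

  -- points of ℓ∞ as directions (u : v)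
  Through : LPt Carrier → Carrier → Carrier → Set
  Through (aff α) u v = u ≈ α * v
  Through vert    u v = v ≈ 0#

  Multiple : Carrier → Carrier → Carrier → LPt Carrier → Set
  Multiple u v c (aff α) = (u ≈ c * α) × (v ≈ c)
  Multiple u v c vert    = (u ≈ c) × (v ≈ 0#)

  scale : LPt Carrier → Carrier → Carrier → Carrier
  scale (aff α) u v = v
  scale vert    u v = u

  conj : LPt Carrier → LPt Carrier
  conj (aff α) = aff (φ α)
  conj vert    = vert

  through-cong : ∀ T {u v u′ v′} → u ≈ u′ → v ≈ v′ → Through T u v → Through T u′ v′
  through-cong (aff α) u≈ v≈ t = trans (sym u≈) (trans t (*-congˡ v≈))
  through-cong vert    u≈ v≈ t = trans (sym v≈) t

  multiple⇒through : ∀ T {u v c} → Multiple u v c T → Through T u v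
  multiple⇒through (aff α) {c = c} (u≈ , v≈) = trans u≈ (trans (*-comm c α) (*-congˡ (sym v≈)))
  multiple⇒through vert    (_ , v≈0) = v≈0

  through⇒multiple : ∀ T {u v} → Through T u v → Multiple u v (scale T u v) T
  through⇒multiple (aff α) t   = trans t (*-comm _ _) , refl
  through⇒multiple vert    v≈0 = refl , v≈0

  multiple-cong : ∀ T {u v u′ v′ c} → u ≈ u′ → v ≈ v′ → Multiple u′ v′ c T → Multiple u v c T
  multiple-cong (aff α) u≈ v≈ (u′≈ , v′≈) = trans u≈ u′≈ , trans v≈ v′≈
  multiple-cong vert    u≈ v≈ (u′≈ , v′≈) = trans u≈ u′≈ , trans v≈ v′≈

  multiple-zero : ∀ T {u v} → u ≈ 0# → v ≈ 0# → Multiple u v 0# T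
  multiple-zero (aff α) u≈0 v≈0 = trans u≈0 (sym (zeroˡ α)) , v≈0
  multiple-zero vert    u≈0 v≈0 = u≈0 , v≈0

  multiple-combine : ∀ T {u₁ v₁ u₂ v₂ a b} l m → Multiple u₁ v₁ a T → Multiple u₂ v₂ b T →
    Multiple (l * u₁ + m * u₂) (l * v₁ + m * v₂) (l * a + m * b) T
  multiple-combine (aff α) {a = a} {b} l m (u₁≈ , v₁≈) (u₂≈ , v₂≈) =
    trans (+-cong (*-congˡ u₁≈) (*-congˡ u₂≈))
          (solve 5 (λ l m a b x → l :* (a :* x) :+ m :* (b :* x) := (l :* a :+ m :* b) :* x) refl l m a b α) ,
    +-cong (*-congˡ v₁≈) (*-congˡ v₂≈)
  multiple-combine vert l m (u₁≈ , v₁≈) (u₂≈ , v₂≈) =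
    +-cong (*-congˡ u₁≈) (*-congˡ u₂≈) , trans (+-cong (trans (*-congˡ v₁≈) (zeroʳ l)) (trans (*-congˡ v₂≈) (zeroʳ m))) (+-identityʳ 0#)

  multiple-decompose : ∀ T {u v u₁ v₁ u₂ v₂ c a b} l m → Multiple u v c T → Multiple u₁ v₁ a T → Multiple u₂ v₂ b T →
    c ≈ l * a + m * b → (u ≈ l * u₁ + m * u₂) × (v ≈ l * v₁ + m * v₂)
  multiple-decompose T l m X∝ U∝ V∝ c≈ with multiple-combine T l m U∝ V∝
  multiple-decompose (aff α) l m (u≈ , v≈) _ _ c≈ | u′≈ , v′≈ =
    trans u≈ (trans (*-congʳ c≈) (sym u′≈)) , trans v≈ (trans c≈ (sym v′≈))
  multiple-decompose vert    l m (u≈ , v≈) _ _ c≈ | u′≈ , v′≈ = trans u≈ (trans c≈ (sym u′≈)) , trans v≈ (sym v′≈)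

  multiple-φ : ∀ T {u v c} → Multiple u v c T → Multiple (φ u) (φ v) (φ c) (conj T)
  multiple-φ (aff α) (u≈ , v≈) = trans (φ.hom-cong u≈) (φ.hom-* _ α) , φ.hom-cong v≈
  multiple-φ vert    (u≈ , v≈) = φ.hom-cong u≈ , trans (φ.hom-cong v≈) φ.hom-0

  scale-rational : ∀ k T {u v} → InF k u → InF k v → InF k (scale T u v)
  scale-rational k (aff α) _  v∈ = v∈
  scale-rational k vert    u∈ _  = u∈

  through-aff-cong : ∀ {α β u v} → α ≈ β → Through (aff α) u v → Through (aff β) u v
  through-aff-cong α≈β through = trans through (*-congʳ α≈β)

  through-φ : ∀ T {u v} → Through T u v → Through (conj T) (φ u) (φ v)
  through-φ T through = multiple⇒through (conj T) (multiple-φ T (through⇒multiple T through))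

  record Combination (X : P5 Carrier) (l : Carrier) (U : P5 Carrier) (m : Carrier) (V : P5 Carrier) : Set where
    field
      xτ≈  : xτ X ≈ l * xτ U + m * xτ V
      yτ≈  : yτ X ≈ l * yτ U + m * yτ V
      xτq≈ : xτq X ≈ l * xτq U + m * xτq V
      yτq≈ : yτq X ≈ l * yτq U + m * yτq V
      z≈   : z X ≈ l * z U + m * z V

  ≈5⇒combination : ∀ {X U V l m} → X ≈5 ((l ·5 U) +5 (m ·5 V)) → Combination X l U m V
  ≈5⇒combination {U = U} {V} {l} {m} (x0≈ , x1≈ , y0≈ , y1≈ , z≈) = record
    { xτ≈  = trans (+-cong x0≈ (*-congʳ x1≈)) (linear l m (x0 U) (x1 U) (x0 V) (x1 V) τ)
    ; yτ≈  = trans (+-cong y0≈ (*-congʳ y1≈)) (linear l m (y0 U) (y1 U) (y0 V) (y1 V) τ)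
    ; xτq≈ = trans (+-cong x0≈ (*-congʳ x1≈)) (linear l m (x0 U) (x1 U) (x0 V) (x1 V) τq)
    ; yτq≈ = trans (+-cong y0≈ (*-congʳ y1≈)) (linear l m (y0 U) (y1 U) (y0 V) (y1 V) τq)
    ; z≈   = z≈
    }

  combination⇒≈5 : ∀ {X U V l m} → Combination X l U m V → X ≈5 ((l ·5 U) +5 (m ·5 V))
  combination⇒≈5 {U = U} {V} {l} {m} comb = coordinates-injective
    (trans xτ≈ (sym (linear l m (x0 U) (x1 U) (x0 V) (x1 V) τ)))
    (trans xτq≈ (sym (linear l m (x0 U) (x1 U) (x0 V) (x1 V) τq)))
    (trans yτ≈ (sym (linear l m (y0 U) (y1 U) (y0 V) (y1 V) τ)))
    (trans yτq≈ (sym (linear l m (y0 U) (y1 U) (y0 V) (y1 V) τq)))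
    z≈
    where open Combination comb

  coordinates-cong : ∀ {X Y} → X ≈5 Y → (xτ X ≈ xτ Y) × (yτ X ≈ yτ Y) × (xτq X ≈ xτq Y) × (yτq X ≈ yτq Y) × (z X ≈ z Y)
  coordinates-cong (x0≈ , x1≈ , y0≈ , y1≈ , z≈) =
    +-cong x0≈ (*-congʳ x1≈) , +-cong y0≈ (*-congʳ y1≈) , +-cong x0≈ (*-congʳ x1≈) , +-cong y0≈ (*-congʳ y1≈) , z≈

  line-swap : ∀ {k U V X} → Line k U V X → Line k V U X
  line-swap (l , m , l∈ , m∈ , (x0≈ , x1≈ , y0≈ , y1≈ , z≈)) =
    m , l , m∈ , l∈ , (trans x0≈ (+-comm _ _) , trans x1≈ (+-comm _ _) , trans y0≈ (+-comm _ _) , trans y1≈ (+-comm _ _) , trans z≈ (+-comm _ _))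

  Directions : P5 Carrier → LPt Carrier → LPt Carrier → Carrier → Carrier → Set
  Directions U r s a c = (z U ≈ 0#) × Multiple (xτ U) (yτ U) a r × Multiple (xτq U) (yτq U) c s

  -- X lies in Σ∞ on the join of the point of g over r and the point of g^q over s
  OnJoin : LPt Carrier → LPt Carrier → P5 Carrier → Set
  OnJoin r s X = (z X ≈ 0#) × Through r (xτ X) (yτ X) × Through s (xτq X) (yτq X)

  combination-at-infinity : ∀ l m {U V} → z U ≈ 0# → z V ≈ 0# → l * z U + m * z V ≈ 0#
  combination-at-infinity l m zU zV = trans (+-cong (trans (*-congˡ zU) (zeroʳ l)) (trans (*-congˡ zV) (zeroʳ m))) (+-identityʳ 0#)

  join-line→ : ∀ {k U V X r s a b c d} → Directions U r s a c → Directions V r s b d → Line k U V X → OnJoin r s X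
  join-line→ {U = U} {V} {X} {r} {s} (zU , U∝r , U∝s) (zV , V∝r , V∝s) (l , m , _ , _ , X≈) =
    trans z≈ (combination-at-infinity l m {U} {V} zU zV) ,
    through-cong r (sym xτ≈) (sym yτ≈) (multiple⇒through r (multiple-combine r l m U∝r V∝r)) ,
    through-cong s (sym xτq≈) (sym yτq≈) (multiple⇒through s (multiple-combine s l m U∝s V∝s))
    where open Combination (≈5⇒combination {X} {U} {V} {l} {m} X≈)

  join-line← : ∀ {k U V X r s a b c d} → Directions U r s a c → Directions V r s b d → OnJoin r s X →
    ∀ {l m} → InF k l → InF k m → l * a + m * b ≈ scale r (xτ X) (yτ X) → l * c + m * d ≈ scale s (xτq X) (yτq X) →
    Line k U V X
  join-line← {U = U} {V} {X} {r} {s} (zU , U∝r , U∝s) (zV , V∝r , V∝s) (zX , X-r , X-s) {l} {m} l∈ m∈ c≈ c′≈ =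
    l , m , l∈ , m∈ , combination⇒≈5 {X} {U} {V} {l} {m} record
      { xτ≈  = proj₁ along-g
      ; yτ≈  = proj₂ along-g
      ; xτq≈ = proj₁ along-gq
      ; yτq≈ = proj₂ along-gq
      ; z≈   = trans zX (sym (combination-at-infinity l m {U} {V} zU zV))
      }
    where
    along-g  = multiple-decompose r l m (through⇒multiple r X-r) U∝r V∝r (sym c≈)
    along-gq = multiple-decompose s l m (through⇒multiple s X-s) U∝s V∝s (sym c′≈)

  1+0*t≈1 : ∀ t → 1# + 0# * t ≈ 1#
  1+0*t≈1 t = trans (+-congˡ (zeroˡ t)) (+-identityʳ 1#)
  0+1*t≈t : ∀ t → 0# + 1# * t ≈ t
  0+1*t≈t t = trans (+-identityˡ _) (*-identityˡ t)
  0+0*t≈0 : ∀ t → 0# + 0# * t ≈ 0#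
  0+0*t≈0 t = trans (+-identityˡ _) (zeroˡ t)
  t+[-1]t≈0 : ∀ t → t + (- 1#) * t ≈ 0#
  t+[-1]t≈0 t = trans (+-congˡ (-1*x≈-x t)) (-‿inverseʳ t)
  τq+[-1]τ≈-δ : τq + (- 1#) * τ ≈ - δ
  τq+[-1]τ≈-δ = trans (+-congˡ (-1*x≈-x τ)) (solve 2 (λ t tq → tq :- t := :- (t :- tq)) refl τ τq)

  -- The spread line [T] is the join of the points of g and g^q over T and T^q.
  spread-directions : ∀ T → Directions (spreadU T) T (conj T) 1# 1# × Directions (spreadV T) T (conj T) τ τq
  spread-directions (aff α) =
    (refl , (trans (solve 3 (λ a d t → (a :- d :* t) :+ d :* t := a) refl α (d1 α) τ) (sym (*-identityˡ α)) , 1+0*t≈1 τ) ,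
            (trans d0+d1τq≈φα (sym (*-identityˡ _)) , 1+0*t≈1 τq)) ,
    (refl , (trans xτV (*-comm α τ) , 0+1*t≈t τ) , (trans xτqV (*-comm _ τq) , 0+1*t≈t τq))
    where
    d = d1 α
    dδ≈ : d * δ ≈ α + - φ α
    dδ≈ = divide-multiply (α + - (α ^ q)) δ≉0
    d0+d1τq≈φα : (α + - (d * τ)) + d * τq ≈ φ α
    d0+d1τq≈φα = begin
      (α + - (d * τ)) + d * τq ≈⟨ solve 4 (λ a d t tq → (a :- d :* t) :+ d :* tq := a :- d :* (t :- tq)) refl α d τ τq ⟩
      α + - (d * δ)            ≈⟨ +-congˡ (-‿cong dδ≈) ⟩
      α + - (α + - φ α)        ≈⟨ solve 2 (λ a f → a :- (a :- f) := f) refl α (φ α) ⟩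
      φ α                      ∎
    τq-quadratic : τq * τq ≈ t1 * τq + t0
    τq-quadratic = trans (sym (φ.hom-* τ τ)) (trans (φ.hom-cong τ-quadratic) (trans (φ.hom-+ _ _)
                     (+-cong (trans (φ.hom-* t1 τ) (*-congʳ (F1⇒φ-fixed t1∈F1))) (F1⇒φ-fixed t0∈F1))))
    drop : ∀ a e → e ≈ 0# → a + - (d * e) ≈ a
    drop a e e≈0 = trans (+-congˡ (trans (-‿cong (trans (*-congˡ e≈0) (zeroʳ d))) -0#≈0#)) (+-identityʳ a)
    xτV : t0 * d + (α + - (d * τ) + t1 * d) * τ ≈ α * τ
    xτV = trans (solve 5 (λ t0 t1 d a t → t0 :* d :+ ((a :- d :* t) :+ t1 :* d) :* t := a :* t :- d :* (t :* t :- (t1 :* t :+ t0)))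
                  refl t0 t1 d α τ) (drop (α * τ) _ (≈⇒diff≈0 τ-quadratic))
    xτqV : t0 * d + (α + - (d * τ) + t1 * d) * τq ≈ φ α * τq
    xτqV = trans (solve 6 (λ t0 t1 d a t tq → t0 :* d :+ ((a :- d :* t) :+ t1 :* d) :* tq
                             := (a :- d :* t :+ d :* tq) :* tq :- d :* (tq :* tq :- (t1 :* tq :+ t0)))
                   refl t0 t1 d α τ τq) (trans (drop _ _ (≈⇒diff≈0 τq-quadratic)) (*-congʳ d0+d1τq≈φα))
  spread-directions vert =
    (refl , (1+0*t≈1 τ , 0+0*t≈0 τ) , (1+0*t≈1 τq , 0+0*t≈0 τq)) ,
    (refl , (0+1*t≈t τ , 0+0*t≈0 τ) , (0+1*t≈t τq , 0+0*t≈0 τq))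

  spread-coefficients : LPt Carrier → P5 Carrier → Carrier × Carrier
  spread-coefficients (aff α) X = y0 X , y1 X
  spread-coefficients vert    X = x0 X , x1 X

  spread-line : ∀ k T {X} → PtPG k X → ([ T ]^ k X → OnJoin T (conj T) X) × (OnJoin T (conj T) X → [ T ]^ k X)
  spread-line k T {X} ((x0∈ , x1∈ , y0∈ , y1∈ , _) , _) =
    join-line→ {k} (proj₁ (spread-directions T)) (proj₂ (spread-directions T)) ,
    λ on-join → join-line← {k} (proj₁ (spread-directions T)) (proj₂ (spread-directions T)) on-join
                  (proj₁ (coefficients-rational T)) (proj₂ (coefficients-rational T)) (equation-g T) (equation-gq T)
    where
    coefficients-rational : ∀ T → InF k (proj₁ (spread-coefficients T X)) × InF k (proj₂ (spread-coefficients T X))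
    coefficients-rational (aff α) = y0∈ , y1∈
    coefficients-rational vert    = x0∈ , x1∈
    equation-g : ∀ T → proj₁ (spread-coefficients T X) * 1# + proj₂ (spread-coefficients T X) * τ ≈ scale T (xτ X) (yτ X)
    equation-g (aff α) = +-congʳ (*-identityʳ _)
    equation-g vert    = +-congʳ (*-identityʳ _)
    equation-gq : ∀ T → proj₁ (spread-coefficients T X) * 1# + proj₂ (spread-coefficients T X) * τq ≈ scale (conj T) (xτq X) (yτq X)
    equation-gq (aff α) = +-congʳ (*-identityʳ _)
    equation-gq vert    = +-congʳ (*-identityʳ _)

  -- U is the multiple a of the point of the transversal g over r (its τq-direction vanishes)
  OnG : P5 Carrier → LPt Carrier → Carrier → Set
  OnG U r a = (z U ≈ 0#) × Multiple (xτ U) (yτ U) a r × (xτq U ≈ 0#) × (yτq U ≈ 0#)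

  -- U is the multiple d of the point of the transversal g^q over s
  OnGq : P5 Carrier → LPt Carrier → Carrier → Set
  OnGq U s d = (z U ≈ 0#) × (xτ U ≈ 0#) × (yτ U ≈ 0#) × Multiple (xτq U) (yτq U) d s

  onG⇒directions : ∀ {U r a} → OnG U r a → ∀ s → Directions U r s a 0#
  onG⇒directions (zU , U∝r , xq≈0 , yq≈0) s = zU , U∝r , multiple-zero s xq≈0 yq≈0

  onGq⇒directions : ∀ {U s d} → OnGq U s d → ∀ r → Directions U r s 0# d
  onGq⇒directions (zU , x≈0 , y≈0 , U∝s) r = zU , multiple-zero r x≈0 y≈0 , U∝s

  φ-τq-pair : ∀ a0 a1 → φ (a0 + a1 * τq) ≈ φ a0 + φ a1 * τ
  φ-τq-pair a0 a1 = trans (φ.hom-+ _ _) (+-congˡ (trans (φ.hom-* _ _) (*-congˡ φτq≈τ)))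

  φ-τ-pair : ∀ a0 a1 → φ (a0 + a1 * τ) ≈ φ a0 + φ a1 * τq
  φ-τ-pair a0 a1 = trans (φ.hom-+ _ _) (+-congˡ (φ.hom-* _ _))

  frobenius-onG : ∀ {U r a} → OnG U r a → OnGq (Frob5 U) (conj r) (φ a)
  frobenius-onG {U} {r} (zU , U∝r , xq≈0 , yq≈0) =
    trans (φ.hom-cong zU) φ.hom-0 ,
    trans (sym (φ-τq-pair (x0 U) (x1 U))) (trans (φ.hom-cong xq≈0) φ.hom-0) ,
    trans (sym (φ-τq-pair (y0 U) (y1 U))) (trans (φ.hom-cong yq≈0) φ.hom-0) ,
    multiple-cong (conj r) (sym (φ-τ-pair (x0 U) (x1 U))) (sym (φ-τ-pair (y0 U) (y1 U))) (multiple-φ r U∝r)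

  frobenius-onGq : ∀ {U s d} → OnGq U s d → OnG (Frob5 U) (conj s) (φ d)
  frobenius-onGq {U} {s} (zU , x≈0 , y≈0 , U∝s) =
    trans (φ.hom-cong zU) φ.hom-0 ,
    multiple-cong (conj s) (sym (φ-τq-pair (x0 U) (x1 U))) (sym (φ-τq-pair (y0 U) (y1 U))) (multiple-φ s U∝s) ,
    trans (sym (φ-τ-pair (x0 U) (x1 U))) (trans (φ.hom-cong x≈0) φ.hom-0) ,
    trans (sym (φ-τ-pair (y0 U) (y1 U))) (trans (φ.hom-cong y≈0) φ.hom-0)

  gPt-onG : ∀ r → OnG (gPt r) r (- δ)
  gPt-onG (aff α) = z≈ , (trans x≈ xτG , trans y≈ τq+[-1]τ≈-δ) , trans xq≈ xτqG , trans yq≈ yτqG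
    where
    simplified : gPt (aff α) ≈5 pt5 (α * τq) (- α) τq (- 1#) 0#
    simplified = +-identityʳ _ , trans (+-identityʳ _) (trans (sym (-‿distribʳ-* α 1#)) (-‿cong (*-identityʳ α))) ,
                 trans (+-congʳ (zeroʳ α)) (+-identityˡ _) , trans (+-congʳ (zeroʳ α)) (+-identityˡ _) ,
                 trans (+-congʳ (zeroʳ α)) (+-identityˡ _)
    x≈ = proj₁ (coordinates-cong simplified)
    y≈ = proj₁ (proj₂ (coordinates-cong simplified))
    xq≈ = proj₁ (proj₂ (proj₂ (coordinates-cong simplified)))
    yq≈ = proj₁ (proj₂ (proj₂ (proj₂ (coordinates-cong simplified))))
    z≈ = proj₂ (proj₂ (proj₂ (proj₂ (coordinates-cong simplified))))
    xτG : α * τq + (- α) * τ ≈ (- δ) * α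
    xτG = solve 3 (λ a t tq → a :* tq :+ (:- a) :* t := (:- (t :- tq)) :* a) refl α τ τq
    xτqG : α * τq + (- α) * τq ≈ 0#
    xτqG = trans (solve 2 (λ a t → a :* t :+ (:- a) :* t := a :* t :- a :* t) refl α τq) (-‿inverseʳ _)
    yτqG : τq + (- 1#) * τq ≈ 0#
    yτqG = t+[-1]t≈0 τq
  gPt-onG vert = refl , (τq+[-1]τ≈-δ , 0+0*t≈0 τ) , t+[-1]t≈0 τq , 0+0*t≈0 τq

  transversal-line : ∀ k → InF k τ → ∀ {U V X r s a d} → OnG U r a → OnGq V s d → ¬ (a ≈ 0#) → ¬ (d ≈ 0#) →
    InF k a → InF k d → PtPG k X → (Line k U V X → OnJoin r s X) × (OnJoin r s X → Line k U V X)
  transversal-line k τ∈ {U} {V} {X} {r} {s} {a} {d} U-on V-on a≉0 d≉0 a∈ d∈ (X∈ , _) =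
    join-line→ {k} (onG⇒directions U-on s) (onGq⇒directions V-on r) ,
    λ on-join → join-line← {k} (onG⇒directions U-on s) (onGq⇒directions V-on r) on-join l∈ m∈
                  (trans (+-cong (divide-multiply c a≉0) (zeroʳ m)) (+-identityʳ c))
                  (trans (+-cong (zeroʳ l) (divide-multiply c′ d≉0)) (+-identityˡ c′))
    where
    coordinates∈ = coordinates-rational k τ∈ X∈
    c  = scale r (xτ X) (yτ X)
    c′ = scale s (xτq X) (yτq X)
    l  = c * a ⁻¹
    m  = c′ * d ⁻¹
    l∈ : InF k l
    l∈ = InF-* k (scale-rational k r (proj₁ coordinates∈) (proj₁ (proj₂ coordinates∈))) (InF-⁻¹ k a≉0 a∈)
    m∈ : InF k m
    m∈ = InF-* k (scale-rational k s (proj₁ (proj₂ (proj₂ coordinates∈))) (proj₂ (proj₂ (proj₂ coordinates∈)))) (InF-⁻¹ k d≉0 d∈)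

  -δ≉0 : ¬ (- δ ≈ 0#)
  -δ≉0 -δ≈0 = δ≉0 (trans (sym (-‿involutive δ)) (trans (-‿cong -δ≈0) -0#≈0#))

  -δ∈F : ∀ k → InF k τ → InF k (- δ)
  -δ∈F k τ∈ = InF-neg k (InF-+ k τ∈ (InF-neg k (InF-φ k τ∈)))

  line-P-Qq : ∀ k → InF k τ → ∀ P Q {X} → PtPG k X →
    (Line k (gPt P) (Frob5 (gPt Q)) X → OnJoin P (conj Q) X) × (OnJoin P (conj Q) X → Line k (gPt P) (Frob5 (gPt Q)) X)
  line-P-Qq k τ∈ P Q = transversal-line k τ∈ (gPt-onG P) (frobenius-onG (gPt-onG Q)) -δ≉0 (φ.hom-nonzero -δ≉0)
                         (-δ∈F k τ∈) (InF-φ k (-δ∈F k τ∈))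

  rational-conjugate : ∀ T {X} → PtPG 1 X → Through T (xτ X) (yτ X) → Through (conj T) (xτq X) (yτq X)
  rational-conjugate T {X} ((x0∈ , x1∈ , y0∈ , y1∈ , _) , _) through =
    through-cong (conj T) (fixed x0∈ x1∈) (fixed y0∈ y1∈) (through-φ T through)
    where
    fixed : ∀ {a0 a1} → InF 1 a0 → InF 1 a1 → φ (a0 + a1 * τ) ≈ a0 + a1 * τq
    fixed a0∈ a1∈ = trans (φ-τ-pair _ _) (+-cong (F1⇒φ-fixed a0∈) (*-congʳ (F1⇒φ-fixed a1∈)))

  quadratic : Conic Carrier → Carrier → Carrier → Carrier
  quadratic D u v = Conic.a D * (u * u) + Conic.b D * (v * v) + Conic.h D * (u * v)

  evalC-at-infinity : ∀ D u v {w} → w ≈ 0# → evalC D u v w ≈ quadratic D u v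
  evalC-at-infinity D u v {w} w≈0 = begin
    Conic.a D * (u * u) + Conic.b D * (v * v) + Conic.c D * (w * w) + Conic.f D * (v * w) + Conic.g D * (u * w) + Conic.h D * (u * v)
      ≈⟨ +-congʳ (+-cong (+-cong (+-congˡ (vanish (Conic.c D) (trans (*-congˡ w≈0) (zeroʳ w)))) (vanish (Conic.f D) (trans (*-congˡ w≈0) (zeroʳ v))))
                        (vanish (Conic.g D) (trans (*-congˡ w≈0) (zeroʳ u)))) ⟩
    Conic.a D * (u * u) + Conic.b D * (v * v) + 0# + 0# + 0# + Conic.h D * (u * v)
      ≈⟨ +-congʳ (trans (+-identityʳ _) (trans (+-identityʳ _) (+-identityʳ _))) ⟩
    quadratic D u v ∎
    where
    vanish : ∀ c {x} → x ≈ 0# → c * x ≈ 0#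
    vanish c x≈0 = trans (*-congˡ x≈0) (zeroʳ c)

  OnBoth : Conic Carrier → P5 Carrier → Set
  OnBoth C X = (z X ≈ 0#) × (quadratic C (xτ X) (yτ X) ≈ 0#) × (quadratic (conjC C) (xτq X) (yτq X) ≈ 0#)

  [O]∩Σ∞⇒onBoth : ∀ C X → ([O] C ∩ Σ∞) X → OnBoth C X
  [O]∩Σ∞⇒onBoth C X ((f∞≈0 , f0≈0) , z≈0) =
    z≈0 , trans (sym (evalC-at-infinity C _ _ z≈0)) f≈0 , trans (sym (evalC-at-infinity (conjC C) _ _ z≈0)) f̄≈0
    where
    f≈0 : FC C X ≈ 0#
    f≈0 = begin
      FC C X                ≈⟨ solve 3 (λ F t g → F := (F :- t :* g) :+ t :* g) refl (FC C X) τ (f0 C X) ⟩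
      f∞ C X + τ * f0 C X   ≈⟨ +-cong f∞≈0 (trans (*-congˡ f0≈0) (zeroʳ τ)) ⟩
      0# + 0#               ≈⟨ +-identityʳ 0# ⟩
      0#                    ∎
    f̄≈0 : FCbar C X ≈ 0#
    f̄≈0 = begin
      FCbar C X                          ≈⟨ solve 2 (λ F G → G := F :- (F :- G)) refl (FC C X) (FCbar C X) ⟩
      FC C X + - (FC C X + - FCbar C X)  ≈⟨ +-cong f≈0 (-‿cong (sym (divide-multiply _ δ≉0))) ⟩
      0# + - (f0 C X * δ)                ≈⟨ +-identityˡ _ ⟩
      - (f0 C X * δ)                     ≈⟨ -‿cong (trans (*-congʳ f0≈0) (zeroˡ δ)) ⟩
      - 0#                               ≈⟨ -0#≈0# ⟩
      0#                                 ∎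

  onBoth⇒[O]∩Σ∞ : ∀ C X → OnBoth C X → ([O] C ∩ Σ∞) X
  onBoth⇒[O]∩Σ∞ C X (z≈0 , Q≈0 , Q̄≈0) = (f∞≈0 , f0≈0) , z≈0
    where
    f≈0 : FC C X ≈ 0#
    f≈0 = trans (evalC-at-infinity C _ _ z≈0) Q≈0
    f̄≈0 : FCbar C X ≈ 0#
    f̄≈0 = trans (evalC-at-infinity (conjC C) _ _ z≈0) Q̄≈0
    f0≈0 : f0 C X ≈ 0#
    f0≈0 = trans (*-congʳ (trans (+-cong f≈0 (-‿cong f̄≈0)) (-‿inverseʳ 0#))) (zeroˡ _)
    f∞≈0 : f∞ C X ≈ 0#
    f∞≈0 = trans (+-cong f≈0 (-‿cong (trans (*-congˡ f0≈0) (zeroʳ τ)))) (-‿inverseʳ 0#)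

  linear-form : LPt Carrier → Carrier → Carrier → Carrier
  linear-form (aff α) u v = u + - (α * v)
  linear-form vert    u v = v

  linear-form⇒through : ∀ T {u v} → linear-form T u v ≈ 0# → Through T u v
  linear-form⇒through (aff α) l≈0 = diff≈0⇒≈ l≈0
  linear-form⇒through vert    l≈0 = l≈0

  through⇒linear-form : ∀ T {u v} → Through T u v → linear-form T u v ≈ 0#
  through⇒linear-form (aff α) t = ≈⇒diff≈0 t
  through⇒linear-form vert    t = t

  -- the coefficients of the form κ · linear-form r1 · linear-form r2
  Factorises : Conic Carrier → Carrier → LPt Carrier → LPt Carrier → Set
  Factorises D κ (aff α) (aff β) = (Conic.a D ≈ κ) × (Conic.h D ≈ - (κ * (α + β))) × (Conic.b D ≈ κ * (α * β))
  Factorises D κ (aff α) vert    = (Conic.a D ≈ 0#) × (Conic.h D ≈ κ) × (Conic.b D ≈ - (κ * α))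
  Factorises D κ vert    (aff β) = (Conic.a D ≈ 0#) × (Conic.h D ≈ κ) × (Conic.b D ≈ - (κ * β))
  Factorises D κ vert    vert    = (Conic.a D ≈ 0#) × (Conic.h D ≈ 0#) × (Conic.b D ≈ κ)

  factorisation : ∀ D κ r1 r2 → Factorises D κ r1 r2 → ∀ u v → quadratic D u v ≈ κ * (linear-form r1 u v * linear-form r2 u v)
  factorisation D κ (aff α) (aff β) (a≈ , h≈ , b≈) u v = trans (+-cong (+-cong (*-congʳ a≈) (*-congʳ b≈)) (*-congʳ h≈))
    (solve 5 (λ k a b u v → k :* (u :* u) :+ k :* (a :* b) :* (v :* v) :+ (:- (k :* (a :+ b))) :* (u :* v)
       := k :* ((u :- a :* v) :* (u :- b :* v))) refl κ α β u v)
  factorisation D κ (aff α) vert (a≈ , h≈ , b≈) u v = trans (+-cong (+-cong (trans (*-congʳ a≈) (zeroˡ _)) (*-congʳ b≈)) (*-congʳ h≈))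
    (trans (+-congʳ (+-identityˡ _))
    (solve 4 (λ k a u v → (:- (k :* a)) :* (v :* v) :+ k :* (u :* v) := k :* ((u :- a :* v) :* v)) refl κ α u v))
  factorisation D κ vert (aff β) (a≈ , h≈ , b≈) u v = trans (+-cong (+-cong (trans (*-congʳ a≈) (zeroˡ _)) (*-congʳ b≈)) (*-congʳ h≈))
    (trans (+-congʳ (+-identityˡ _))
    (solve 4 (λ k a u v → (:- (k :* a)) :* (v :* v) :+ k :* (u :* v) := k :* (v :* (u :- a :* v))) refl κ β u v))
  factorisation D κ vert vert (a≈ , h≈ , b≈) u v = trans (+-cong (+-cong (trans (*-congʳ a≈) (zeroˡ _)) (*-congʳ b≈))
    (trans (*-congʳ h≈) (zeroˡ _))) (trans (+-identityʳ _) (+-identityˡ _))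

  factorises-conj : ∀ D κ r1 r2 → Factorises D κ r1 r2 → Factorises (conjC D) (φ κ) (conj r1) (conj r2)
  factorises-conj D κ (aff α) (aff β) (a≈ , h≈ , b≈) =
    φ.hom-cong a≈ ,
    trans (φ.hom-cong h≈) (trans (φ.hom-neg _) (-‿cong (trans (φ.hom-* _ _) (*-congˡ (φ.hom-+ α β))))) ,
    trans (φ.hom-cong b≈) (trans (φ.hom-* _ _) (*-congˡ (φ.hom-* α β)))
  factorises-conj D κ (aff α) vert (a≈ , h≈ , b≈) =
    trans (φ.hom-cong a≈) φ.hom-0 , φ.hom-cong h≈ , trans (φ.hom-cong b≈) (trans (φ.hom-neg _) (-‿cong (φ.hom-* κ α)))
  factorises-conj D κ vert (aff β) (a≈ , h≈ , b≈) =
    trans (φ.hom-cong a≈) φ.hom-0 , φ.hom-cong h≈ , trans (φ.hom-cong b≈) (trans (φ.hom-neg _) (-‿cong (φ.hom-* κ β)))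
  factorises-conj D κ vert vert (a≈ , h≈ , b≈) =
    trans (φ.hom-cong a≈) φ.hom-0 , trans (φ.hom-cong h≈) φ.hom-0 , φ.hom-cong b≈

  factorised-zeros→ : ∀ D κ r1 r2 → ¬ (κ ≈ 0#) → Factorises D κ r1 r2 → ∀ {u v} →
    quadratic D u v ≈ 0# → Through r1 u v ⊎ Through r2 u v
  factorised-zeros→ D κ r1 r2 κ≉0 fact {u} {v} Q≈0
    with zero-product (cancel-nonzero κ≉0 (trans (sym (factorisation D κ r1 r2 fact u v)) Q≈0))
  ... | inj₁ l1≈0 = inj₁ (linear-form⇒through r1 l1≈0)
  ... | inj₂ l2≈0 = inj₂ (linear-form⇒through r2 l2≈0)

  factorised-zeros← : ∀ D κ r1 r2 → Factorises D κ r1 r2 → ∀ {u v} →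
    Through r1 u v ⊎ Through r2 u v → quadratic D u v ≈ 0#
  factorised-zeros← D κ r1 r2 fact {u} {v} through =
    trans (factorisation D κ r1 r2 fact u v) (trans (*-congˡ (product≈0 through)) (zeroʳ κ))
    where
    product≈0 : Through r1 u v ⊎ Through r2 u v → linear-form r1 u v * linear-form r2 u v ≈ 0#
    product≈0 (inj₁ t1) = trans (*-congʳ (through⇒linear-form r1 t1)) (zeroˡ _)
    product≈0 (inj₂ t2) = trans (*-congˡ (through⇒linear-form r2 t2)) (zeroʳ _)

  OnJoins : LPt Carrier → LPt Carrier → P5 Carrier → Set
  OnJoins r1 r2 X = (z X ≈ 0#) × (Through r1 (xτ X) (yτ X) ⊎ Through r2 (xτ X) (yτ X))
                                × (Through (conj r1) (xτq X) (yτq X) ⊎ Through (conj r2) (xτq X) (yτq X))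

  points-at-infinity : ∀ C κ r1 r2 → ¬ (κ ≈ 0#) → Factorises C κ r1 r2 →
    ∀ X → (([O] C ∩ Σ∞) X → OnJoins r1 r2 X) × (OnJoins r1 r2 X → ([O] C ∩ Σ∞) X)
  points-at-infinity C κ r1 r2 κ≉0 fact X =
    (λ X∈ → let (z≈0 , Q≈0 , Q̄≈0) = [O]∩Σ∞⇒onBoth C X X∈ in
       z≈0 , factorised-zeros→ C κ r1 r2 κ≉0 fact Q≈0 ,
       factorised-zeros→ (conjC C) (φ κ) (conj r1) (conj r2) (φ.hom-nonzero κ≉0) (factorises-conj C κ r1 r2 fact) Q̄≈0) ,
    (λ { (z≈0 , t , t̄) → onBoth⇒[O]∩Σ∞ C X (z≈0 , factorised-zeros← C κ r1 r2 fact t ,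
                           factorised-zeros← (conjC C) (φ κ) (conj r1) (conj r2) (factorises-conj C κ r1 r2 fact) t̄) })

  module PointsAtInfinity (C : Conic Carrier) (C-over : ConicOver 2 C) (nondegenerate : NonDegenerate C) where
    open Conic C using (a; b; h)

    a∈F2 : InF 2 a
    a∈F2 = proj₁ C-over
    b∈F2 : InF 2 b
    b∈F2 = proj₁ (proj₂ C-over)
    h∈F2 : InF 2 h
    h∈F2 = proj₂ (proj₂ (proj₂ (proj₂ (proj₂ C-over))))

    E : Conic Carrier → Carrier → Carrier
    E D w = Conic.a D * (w * w) + Conic.h D * w + Conic.b D

    quadratic-at-aff : ∀ D w → quadratic D w 1# ≈ E D w
    quadratic-at-aff D w = trans (+-cong (+-congˡ (trans (*-congˡ (*-identityʳ 1#)) (*-identityʳ _))) (*-congˡ (*-identityʳ w)))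
      (solve 3 (λ A B H → A :+ B :+ H := A :+ H :+ B) refl _ _ _)

    quadratic-at-vert : ∀ D → quadratic D 1# 0# ≈ Conic.a D
    quadratic-at-vert D = trans (+-cong (+-cong (trans (*-congˡ (*-identityʳ 1#)) (*-identityʳ _)) (trans (*-congˡ (zeroʳ 0#)) (zeroʳ _)))
                                        (trans (*-congˡ (zeroʳ 1#)) (zeroʳ _))) (trans (+-identityʳ _) (+-identityʳ _))

    on-aff→ : ∀ D w → OnConicL D (aff w) → E D w ≈ 0#
    on-aff→ D w on = trans (sym (quadratic-at-aff D w)) (trans (sym (evalC-at-infinity D w 1# refl)) on)
    on-aff← : ∀ D w → E D w ≈ 0# → OnConicL D (aff w)
    on-aff← D w E≈0 = trans (evalC-at-infinity D w 1# refl) (trans (quadratic-at-aff D w) E≈0)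
    on-vert→ : ∀ D → OnConicL D vert → Conic.a D ≈ 0#
    on-vert→ D on = trans (sym (quadratic-at-vert D)) (trans (sym (evalC-at-infinity D 1# 0# refl)) on)
    on-vert← : ∀ D → Conic.a D ≈ 0# → OnConicL D vert
    on-vert← D a≈0 = trans (evalC-at-infinity D 1# 0# refl) (trans (quadratic-at-vert D) a≈0)

    b-from-root : ∀ {α β} → h ≈ - (a * (α + β)) → E C α ≈ 0# → b ≈ a * (α * β)
    b-from-root {α} {β} h≈ Eα≈0 = begin
      b                                           ≈⟨ solve 4 (λ a h b x → b := (a :* (x :* x) :+ h :* x :+ b) :- a :* (x :* x) :- h :* x) refl a h b α ⟩
      E C α + - (a * (α * α)) + - (h * α)         ≈⟨ +-cong (+-congʳ Eα≈0) (-‿cong (*-congʳ h≈)) ⟩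
      0# + - (a * (α * α)) + - (- (a * (α + β)) * α) ≈⟨ +-congʳ (+-identityˡ _) ⟩
      - (a * (α * α)) + - (- (a * (α + β)) * α)   ≈⟨ solve 3 (λ a x y → :- (a :* (x :* x)) :- (:- (a :* (x :+ y)) :* x) := a :* (x :* y)) refl a α β ⟩
      a * (α * β)                                 ∎

    -- Vieta: two distinct roots determine the factorisation
    two-roots : ∀ {α β} → ¬ (α ≈ β) → E C α ≈ 0# → E C β ≈ 0# → Factorises C a (aff α) (aff β)
    two-roots {α} {β} α≉β Eα≈0 Eβ≈0 = refl , h≈ , b-from-root h≈ Eα≈0
      where
      product≈0 : (α + - β) * (a * (α + β) + h) ≈ 0#
      product≈0 = trans (solve 5 (λ a h b x y → (x :- y) :* (a :* (x :+ y) :+ h)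
                                       := (a :* (x :* x) :+ h :* x :+ b) :- (a :* (y :* y) :+ h :* y :+ b)) refl a h b α β)
                    (trans (+-cong Eα≈0 (-‿cong Eβ≈0)) (-‿inverseʳ 0#))
      h≈ : h ≈ - (a * (α + β))
      h≈ = trans (solve 2 (λ h s → h := (s :+ h) :- s) refl h (a * (α + β)))
             (trans (+-congʳ (cancel-nonzero (λ α-β≈0 → α≉β (diff≈0⇒≈ α-β≈0)) product≈0)) (+-identityˡ _))

    vert-and-root : ∀ {β} → a ≈ 0# → E C β ≈ 0# → Factorises C h vert (aff β)
    vert-and-root {β} a≈0 Eβ≈0 = a≈0 , refl , (begin
      b                                     ≈⟨ solve 4 (λ a h b x → b := (a :* (x :* x) :+ h :* x :+ b) :- a :* (x :* x) :- h :* x) refl a h b β ⟩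
      E C β + - (a * (β * β)) + - (h * β)   ≈⟨ +-congʳ (+-cong Eβ≈0 (-‿cong (trans (*-congʳ a≈0) (zeroˡ _)))) ⟩
      0# + - 0# + - (h * β)                 ≈⟨ +-congʳ (-‿inverseʳ 0#) ⟩
      0# + - (h * β)                        ≈⟨ +-identityˡ _ ⟩
      - (h * β)                             ∎)

    -- a non-degenerate conic does not contain ℓ∞
    not-all-zero : a ≈ 0# → h ≈ 0# → ¬ (b ≈ 0#)
    not-all-zero a≈0 h≈0 b≈0 = nondegenerate (begin
      four * a * b * c + - (a * (f * f)) + - (b * (g * g)) + - (c * (h * h)) + f * g * h
        ≈⟨ +-cong (+-cong (+-cong (+-cong 4abc≈0 (-‿cong (trans (*-congʳ a≈0) (zeroˡ _)))) (-‿cong (trans (*-congʳ b≈0) (zeroˡ _))))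
             (-‿cong (trans (*-congˡ (trans (*-congʳ h≈0) (zeroˡ _))) (zeroʳ c)))) (trans (*-congˡ h≈0) (zeroʳ _)) ⟩
      0# + - 0# + - 0# + - 0# + 0#  ≈⟨ +-cong (+-cong (+-cong (+-cong refl -0#≈0#) -0#≈0#) -0#≈0#) refl ⟩
      0# + 0# + 0# + 0# + 0#        ≈⟨ trans (+-identityʳ _) (trans (+-identityʳ _) (trans (+-identityʳ _) (+-identityʳ _))) ⟩
      0#                            ∎)
      where
      open Conic C using (c; f; g)
      4abc≈0 : four * a * b * c ≈ 0#
      4abc≈0 = trans (*-congʳ (trans (*-congʳ (trans (*-congˡ a≈0) (zeroʳ four))) (zeroˡ b))) (zeroˡ c)

    b≈0-if-root : ∀ {β} → a ≈ 0# → h ≈ 0# → E C β ≈ 0# → b ≈ 0#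
    b≈0-if-root a≈0 h≈0 Eβ≈0 = trans (sym (+-identityˡ b))
      (trans (+-congʳ (sym (trans (+-cong (trans (*-congʳ a≈0) (zeroˡ _)) (trans (*-congʳ h≈0) (zeroˡ _))) (+-identityʳ 0#)))) Eβ≈0)

    Secant : LPt Carrier → LPt Carrier → Set
    Secant P Q = (R : LPt Carrier) → RatL 2 R → (OnConicL C R → (R ~L P) ⊎ (R ~L Q)) × ((R ~L P) ⊎ (R ~L Q) → OnConicL C R)

    secant-factorisation : ∀ P Q → ¬ (P ~L Q) → Secant P Q → RatL 2 P → RatL 2 Q → Σ Carrier λ κ → ¬ (κ ≈ 0#) × Factorises C κ P Q
    secant-factorisation (aff α) (aff β) α≉β secant α∈ β∈ =
      a , a≉0 , two-roots α≉β (on-aff→ C α (proj₂ (secant (aff α) α∈) (inj₁ refl)))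
                              (on-aff→ C β (proj₂ (secant (aff β) β∈) (inj₂ refl)))
      where
      a≉0 : ¬ (a ≈ 0#)
      a≉0 a≈0 with proj₁ (secant vert tt) (on-vert← C a≈0)
      ... | inj₁ ()
      ... | inj₂ ()
    secant-factorisation (aff α) vert _ secant α∈ _ = h , h≉0 , vert-and-root a≈0 Eα≈0
      where
      a≈0 = on-vert→ C (proj₂ (secant vert tt) (inj₂ tt))
      Eα≈0 = on-aff→ C α (proj₂ (secant (aff α) α∈) (inj₁ refl))
      h≉0 : ¬ (h ≈ 0#)
      h≉0 h≈0 = not-all-zero a≈0 h≈0 (b≈0-if-root a≈0 h≈0 Eα≈0)
    secant-factorisation vert (aff β) _ secant _ β∈ = h , h≉0 , vert-and-root a≈0 Eβ≈0
      where
      a≈0 = on-vert→ C (proj₂ (secant vert tt) (inj₁ tt))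
      Eβ≈0 = on-aff→ C β (proj₂ (secant (aff β) β∈) (inj₂ refl))
      h≉0 : ¬ (h ≈ 0#)
      h≉0 h≈0 = not-all-zero a≈0 h≈0 (b≈0-if-root a≈0 h≈0 Eβ≈0)
    secant-factorisation vert vert P≁Q _ _ _ = ⊥-elim (P≁Q tt)

    Tangent : LPt Carrier → Set
    Tangent P = (R : LPt Carrier) → RatL 2 R → (OnConicL C R → R ~L P) × (R ~L P → OnConicL C R)

    tangent-factorisation : ∀ P → Tangent P → RatL 2 P → Σ Carrier λ κ → ¬ (κ ≈ 0#) × Factorises C κ P P
    tangent-factorisation (aff α) tangent α∈ = a , a≉0 , (refl , h≈ , b-from-root h≈ Eα≈0)
      where
      a≉0 : ¬ (a ≈ 0#)
      a≉0 a≈0 = proj₁ (tangent vert tt) (on-vert← C a≈0)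
      Eα≈0 = on-aff→ C α (proj₂ (tangent (aff α) α∈) refl)
      -- the second root β = −h/a − α is again in F_{q²}, hence equals α
      k = h * a ⁻¹
      β = - k + - α
      β∈F2 : InF 2 β
      β∈F2 = InF-+ 2 (InF-neg 2 (InF-* 2 h∈F2 (InF-⁻¹ 2 a≉0 a∈F2))) (InF-neg 2 α∈)
      h≈ak : h ≈ a * k
      h≈ak = trans (sym (divide-multiply h a≉0)) (*-comm _ _)
      Eβ≈0 : E C β ≈ 0#
      Eβ≈0 = begin
        a * (β * β) + h * β + b        ≈⟨ +-congʳ (+-congˡ (*-congʳ h≈ak)) ⟩
        a * (β * β) + (a * k) * β + b  ≈⟨ solve 4 (λ a k x b → a :* ((:- k :- x) :* (:- k :- x)) :+ (a :* k) :* (:- k :- x) :+ b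
                                                 := a :* (x :* x) :+ (a :* k) :* x :+ b) refl a k α b ⟩
        a * (α * α) + (a * k) * α + b  ≈⟨ +-congʳ (+-congˡ (*-congʳ (sym h≈ak))) ⟩
        E C α                          ≈⟨ Eα≈0 ⟩
        0#                             ∎
      β≈α : β ≈ α
      β≈α = proj₁ (tangent (aff β) β∈F2) (on-aff← C β Eβ≈0)
      h≈ : h ≈ - (a * (α + α))
      h≈ = begin
        h                ≈⟨ h≈ak ⟩
        a * k            ≈⟨ *-congˡ (solve 2 (λ k x → k := :- ((:- k :- x) :+ x)) refl k α) ⟩
        a * - (β + α)    ≈⟨ *-congˡ (-‿cong (+-congʳ β≈α)) ⟩
        a * - (α + α)    ≈⟨ sym (-‿distribʳ-* a (α + α)) ⟩
        - (a * (α + α))  ∎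
    tangent-factorisation vert tangent _ with h ≟ 0#
    ... | yes h≈0 = b , not-all-zero a≈0 h≈0 , (a≈0 , h≈0 , refl)
      where a≈0 = on-vert→ C (proj₂ (tangent vert tt) tt)
    ... | no  h≉0 = ⊥-elim (proj₁ (tangent (aff w) w∈F2) (on-aff← C w Ew≈0))
      where
      -- otherwise w = −b/h would be a second root in F_{q²}
      a≈0 = on-vert→ C (proj₂ (tangent vert tt) tt)
      w = (- b) * h ⁻¹
      w∈F2 : InF 2 w
      w∈F2 = InF-* 2 (InF-neg 2 b∈F2) (InF-⁻¹ 2 h≉0 h∈F2)
      Ew≈0 : E C w ≈ 0#
      Ew≈0 = begin
        a * (w * w) + h * w + b           ≈⟨ +-congʳ (+-cong (trans (*-congʳ a≈0) (zeroˡ _))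
                                               (solve 3 (λ h x i → h :* (x :* i) := x :* (h :* i)) refl h (- b) (h ⁻¹))) ⟩
        0# + (- b) * (h * h ⁻¹) + b       ≈⟨ +-congʳ (trans (+-identityˡ _) (trans (*-congˡ (⁻¹-inv h h≉0)) (*-identityʳ _))) ⟩
        - b + b                           ≈⟨ -‿inverseˡ b ⟩
        0#                                ∎

    Exterior : Set
    Exterior = (R : LPt Carrier) → RatL 2 R → ¬ OnConicL C R

    E-cong : ∀ {x y} → x ≈ y → E C x ≈ E C y
    E-cong x≈y = +-cong (+-cong (*-congˡ (*-cong x≈y x≈y)) (*-congˡ x≈y)) refl

    -- the conic is defined over F_{q²}, so Φ 2 permutes its points
    E-Φ2 : ∀ w → E C (Φ 2 w) ≈ Φ 2 (E C w)
    E-Φ2 w = sym (trans (Φ.hom-+ 2 _ _) (+-cong (trans (Φ.hom-+ 2 _ _) (+-cong (trans (Φ.hom-* 2 _ _) (*-cong a∈F2 (Φ.hom-* 2 w w)))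
                                                                         (trans (Φ.hom-* 2 _ _) (*-congʳ h∈F2)))) b∈F2))

    conjugate-root : ∀ {w} → E C w ≈ 0# → E C (φ (φ w)) ≈ 0#
    conjugate-root {w} Ew≈0 = trans (E-cong (φ∘φ w)) (trans (E-Φ2 w) (trans (Φ.hom-cong 2 Ew≈0) (Φ.hom-0 2)))

    exterior-factorisation : Exterior → ∀ {α} → E C α ≈ 0# → ¬ (a ≈ 0#) × Factorises C a (aff α) (aff (φ (φ α)))
    exterior-factorisation exterior {α} Eα≈0 = a≉0 , two-roots α≉α̅ Eα≈0 (conjugate-root Eα≈0)
      where
      a≉0 : ¬ (a ≈ 0#)
      a≉0 a≈0 = exterior vert tt (on-vert← C a≈0)
      α≉α̅ : ¬ (α ≈ φ (φ α))
      α≉α̅ α≈α̅ = exterior (aff α) (trans (sym (φ∘φ α)) (sym α≈α̅)) (on-aff← C α Eα≈0)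

    rational-direction-vanishes : Exterior → ∀ {β u v} → E C β ≈ 0# → InF 2 u → InF 2 v → Through (aff β) u v → (u ≈ 0#) × (v ≈ 0#)
    rational-direction-vanishes exterior {β} {u} {v} Eβ≈0 u∈ v∈ u≈βv with v ≟ 0#
    ... | yes v≈0 = trans u≈βv (trans (*-congˡ v≈0) (zeroʳ β)) , v≈0
    ... | no  v≉0 = ⊥-elim (exterior (aff β) (InF-cong 2 β≈u/v (InF-* 2 u∈ (InF-⁻¹ 2 v≉0 v∈))) (on-aff← C β Eβ≈0))
      where
      β≈u/v : β ≈ u * v ⁻¹
      β≈u/v = trans (sym (trans (*-assoc β v (v ⁻¹)) (trans (*-congˡ (⁻¹-inv v v≉0)) (*-identityʳ β)))) (*-congʳ (sym u≈βv))

    secant-lines : ∀ k → InF k τ → ∀ P Q κ → ¬ (κ ≈ 0#) → Factorises C κ P Q →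
      SetEqPG k ([O] C ∩ Σ∞) ((([ P ]^ k ∪ [ Q ]^ k) ∪ Line k (gPt P) (Frob5 (gPt Q))) ∪ Line k (Frob5 (gPt P)) (gPt Q))
    secant-lines k τ∈ P Q κ κ≉0 factorises X X∈ = (λ X∈O → to (proj₁ [O]∩Σ∞ X∈O)) , (λ X∈lines → proj₂ [O]∩Σ∞ (from X∈lines))
      where
      [O]∩Σ∞ = points-at-infinity C κ P Q κ≉0 factorises X
      [P] = spread-line k P X∈
      [Q] = spread-line k Q X∈
      PQq = line-P-Qq k τ∈ P Q X∈
      QPq = line-P-Qq k τ∈ Q P X∈
      to : OnJoins P Q X → ((([ P ]^ k ∪ [ Q ]^ k) ∪ Line k (gPt P) (Frob5 (gPt Q))) ∪ Line k (Frob5 (gPt P)) (gPt Q)) X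
      to (z≈0 , inj₁ P-g , inj₁ P-gq) = inj₁ (inj₁ (inj₁ (proj₂ [P] (z≈0 , P-g , P-gq))))
      to (z≈0 , inj₂ Q-g , inj₂ Q-gq) = inj₁ (inj₁ (inj₂ (proj₂ [Q] (z≈0 , Q-g , Q-gq))))
      to (z≈0 , inj₁ P-g , inj₂ Q-gq) = inj₁ (inj₂ (proj₂ PQq (z≈0 , P-g , Q-gq)))
      to (z≈0 , inj₂ Q-g , inj₁ P-gq) = inj₂ (line-swap {k} (proj₂ QPq (z≈0 , Q-g , P-gq)))
      from : ((([ P ]^ k ∪ [ Q ]^ k) ∪ Line k (gPt P) (Frob5 (gPt Q))) ∪ Line k (Frob5 (gPt P)) (gPt Q)) X → OnJoins P Q X
      from (inj₁ (inj₁ (inj₁ X∈[P]))) = let (z≈0 , P-g , P-gq) = proj₁ [P] X∈[P] in z≈0 , inj₁ P-g , inj₁ P-gq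
      from (inj₁ (inj₁ (inj₂ X∈[Q]))) = let (z≈0 , Q-g , Q-gq) = proj₁ [Q] X∈[Q] in z≈0 , inj₂ Q-g , inj₂ Q-gq
      from (inj₁ (inj₂ X∈PQq))         = let (z≈0 , P-g , Q-gq) = proj₁ PQq X∈PQq in z≈0 , inj₁ P-g , inj₂ Q-gq
      from (inj₂ X∈PqQ)                = let (z≈0 , Q-g , P-gq) = proj₁ QPq (line-swap {k} X∈PqQ) in z≈0 , inj₂ Q-g , inj₁ P-gq

    secant-spreads : ∀ P Q κ → ¬ (κ ≈ 0#) → Factorises C κ P Q → SetEqPG 1 ([O] C ∩ Σ∞) ([ P ]^ 1 ∪ [ Q ]^ 1)
    secant-spreads P Q κ κ≉0 factorises X X∈ = (λ X∈O → to (proj₁ [O]∩Σ∞ X∈O)) , (λ X∈lines → proj₂ [O]∩Σ∞ (from X∈lines))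
      where
      [O]∩Σ∞ = points-at-infinity C κ P Q κ≉0 factorises X
      to : OnJoins P Q X → ([ P ]^ 1 ∪ [ Q ]^ 1) X
      to (z≈0 , inj₁ P-g , _) = inj₁ (proj₂ (spread-line 1 P X∈) (z≈0 , P-g , rational-conjugate P X∈ P-g))
      to (z≈0 , inj₂ Q-g , _) = inj₂ (proj₂ (spread-line 1 Q X∈) (z≈0 , Q-g , rational-conjugate Q X∈ Q-g))
      from : ([ P ]^ 1 ∪ [ Q ]^ 1) X → OnJoins P Q X
      from (inj₁ X∈[P]) = let (z≈0 , P-g , P-gq) = proj₁ (spread-line 1 P X∈) X∈[P] in z≈0 , inj₁ P-g , inj₁ P-gq
      from (inj₂ X∈[Q]) = let (z≈0 , Q-g , Q-gq) = proj₁ (spread-line 1 Q X∈) X∈[Q] in z≈0 , inj₂ Q-g , inj₂ Q-gq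

    tangent-spread : ∀ k P κ → ¬ (κ ≈ 0#) → Factorises C κ P P → SetEqPG k ([O] C ∩ Σ∞) ([ P ]^ k)
    tangent-spread k P κ κ≉0 factorises X X∈ =
      (λ X∈O → proj₂ (spread-line k P X∈) (merge (proj₁ [O]∩Σ∞ X∈O))) ,
      (λ X∈[P] → let (z≈0 , P-g , P-gq) = proj₁ (spread-line k P X∈) X∈[P] in proj₂ [O]∩Σ∞ (z≈0 , inj₁ P-g , inj₁ P-gq))
      where
      [O]∩Σ∞ = points-at-infinity C κ P P κ≉0 factorises X
      either : ∀ {A : Set} → A ⊎ A → A
      either (inj₁ x) = x
      either (inj₂ x) = x
      merge : OnJoins P P X → OnJoin P (conj P) X
      merge (z≈0 , P-g , P-gq) = z≈0 , either P-g , either P-gq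

    module ExteriorCase (exterior : Exterior) (α : Carrier) (Eα≈0 : E C α ≈ 0#) where
      α₁ α₂ α₃ : Carrier
      α₁ = φ α
      α₂ = φ α₁
      α₃ = φ α₂

      a≉0 : ¬ (a ≈ 0#)
      a≉0 = proj₁ (exterior-factorisation exterior Eα≈0)
      factorises : Factorises C a (aff α) (aff α₂)
      factorises = proj₂ (exterior-factorisation exterior Eα≈0)

      -- a point of [O] ∩ Σ∞ over F_{q²} has both directions zero, hence is zero
      empty-over-Fq2 : EmptyPG 2 ([O] C ∩ Σ∞)
      empty-over-Fq2 X (X-rational , X≉0) X∈O = X≉0 (coordinates-injective
              (trans (proj₁ g-zero) (sym (0+0*t≈0 τ))) (trans (proj₁ gq-zero) (sym (0+0*t≈0 τq)))
              (trans (proj₂ g-zero) (sym (0+0*t≈0 τ))) (trans (proj₂ gq-zero) (sym (0+0*t≈0 τq))) z≈0)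
        where
        on-joins = proj₁ (points-at-infinity C (Conic.a C) (aff α) (aff α₂) a≉0 factorises X) X∈O
        z≈0 = proj₁ on-joins
        through-g = proj₁ (proj₂ on-joins)
        through-gq = proj₂ (proj₂ on-joins)
        coordinates∈ = coordinates-rational 2 τ∈F2 X-rational
        x∈ = proj₁ coordinates∈
        y∈ = proj₁ (proj₂ coordinates∈)
        xq∈ = proj₁ (proj₂ (proj₂ coordinates∈))
        yq∈ = proj₂ (proj₂ (proj₂ coordinates∈))
        g-zero : (xτ X ≈ 0#) × (yτ X ≈ 0#)
        g-zero = [ rational-direction-vanishes exterior Eα≈0 x∈ y∈
                 , rational-direction-vanishes exterior (conjugate-root Eα≈0) x∈ y∈ ] through-g
        -- apply φ to bring the conjugate direction back to the roots α₂, α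
        φ-gq-zero : (φ (xτq X) ≈ 0#) × (φ (yτq X) ≈ 0#)
        φ-gq-zero = [ (λ t → rational-direction-vanishes exterior (conjugate-root Eα≈0) (InF-φ 2 xq∈) (InF-φ 2 yq∈) (through-φ (aff α₁) t))
                    , (λ t → rational-direction-vanishes exterior Eα≈0 (InF-φ 2 xq∈) (InF-φ 2 yq∈)
                               (through-aff-cong (φ⁴-identity α) (through-φ (aff α₃) t))) ] through-gq
        gq-zero : (xτq X ≈ 0#) × (yτq X ≈ 0#)
        gq-zero = φ-injective-at-0 (proj₁ φ-gq-zero) , φ-injective-at-0 (proj₂ φ-gq-zero)

      empty-over-Fq : EmptyPG 1 ([O] C ∩ Σ∞)
      empty-over-Fq X ((x0∈ , x1∈ , y0∈ , y1∈ , z∈) , X≉0) =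
        empty-over-Fq2 X ((F1⊆F2 x0∈ , F1⊆F2 x1∈ , F1⊆F2 y0∈ , F1⊆F2 y1∈ , F1⊆F2 z∈) , X≉0)

      -- the conjugates of P = αA0 + A1 alternate between g and g^q
      P₀ : P5 Carrier
      P₀ = gPt (aff α)
      on₀ : OnG P₀ (aff α) (- δ)
      on₀ = gPt-onG (aff α)
      on₁ : OnGq (Frob5^ 1 P₀) (aff α₁) (φ (- δ))
      on₁ = frobenius-onG {P₀} {aff α} on₀
      on₂ : OnG (Frob5^ 2 P₀) (aff α₂) (φ (φ (- δ)))
      on₂ = frobenius-onGq {Frob5^ 1 P₀} {aff α₁} on₁
      on₃ : OnGq (Frob5^ 3 P₀) (aff α₃) (φ (φ (φ (- δ))))
      on₃ = frobenius-onG {Frob5^ 2 P₀} {aff α₂} on₂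
      on₄ : OnG (Frob5^ 4 P₀) (aff (φ α₃)) (φ (φ (φ (φ (- δ)))))
      on₄ = frobenius-onGq {Frob5^ 3 P₀} {aff α₃} on₃

      -- over F_{q⁴} = K every element is rational
      line-over-K : ∀ {U V X r s a d} → OnG U r a → OnGq V s d → ¬ (a ≈ 0#) → ¬ (d ≈ 0#) → PtPG 4 X →
        (Line 4 U V X → OnJoin r s X) × (OnJoin r s X → Line 4 U V X)
      line-over-K {a = a} {d} U-on V-on a≉0 d≉0 = transversal-line 4 (F2⊆F4 τ∈F2) U-on V-on a≉0 d≉0 (fermat a) (fermat d)

      ≉0₁ : ¬ (φ (- δ) ≈ 0#)
      ≉0₁ = φ.hom-nonzero -δ≉0
      ≉0₂ : ¬ (φ (φ (- δ)) ≈ 0#)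
      ≉0₂ = φ.hom-nonzero ≉0₁
      ≉0₃ : ¬ (φ (φ (φ (- δ))) ≈ 0#)
      ≉0₃ = φ.hom-nonzero ≉0₂
      ≉0₄ : ¬ (φ (φ (φ (φ (- δ)))) ≈ 0#)
      ≉0₄ = φ.hom-nonzero ≉0₃

      four-lines : SetEqPG 4 ([O] C ∩ Σ∞)
        (((Line 4 P₀ (Frob5^ 1 P₀) ∪ Line 4 (Frob5^ 1 P₀) (Frob5^ 2 P₀)) ∪ Line 4 (Frob5^ 2 P₀) (Frob5^ 3 P₀))
          ∪ Line 4 (Frob5^ 3 P₀) (Frob5^ 4 P₀))
      four-lines X X∈ = (λ X∈O → to (proj₁ [O]∩Σ∞ X∈O)) , (λ X∈lines → proj₂ [O]∩Σ∞ (from X∈lines))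
        where
        [O]∩Σ∞ = points-at-infinity C (Conic.a C) (aff α) (aff α₂) a≉0 factorises X
        ℓ₀₁ = line-over-K {r = aff α} {aff α₁} on₀ on₁ -δ≉0 ≉0₁ X∈
        ℓ₂₁ = line-over-K {r = aff α₂} {aff α₁} on₂ on₁ ≉0₂ ≉0₁ X∈
        ℓ₂₃ = line-over-K {r = aff α₂} {aff α₃} on₂ on₃ ≉0₂ ≉0₃ X∈
        ℓ₄₃ = line-over-K {r = aff (φ α₃)} {aff α₃} on₄ on₃ ≉0₄ ≉0₃ X∈
        Lines = (((Line 4 P₀ (Frob5^ 1 P₀) ∪ Line 4 (Frob5^ 1 P₀) (Frob5^ 2 P₀)) ∪ Line 4 (Frob5^ 2 P₀) (Frob5^ 3 P₀))
                  ∪ Line 4 (Frob5^ 3 P₀) (Frob5^ 4 P₀))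
        to : OnJoins (aff α) (aff α₂) X → Lines X
        to (z≈0 , inj₁ α-g  , inj₁ α₁-gq) = inj₁ (inj₁ (inj₁ (proj₂ ℓ₀₁ (z≈0 , α-g , α₁-gq))))
        to (z≈0 , inj₂ α₂-g , inj₁ α₁-gq) = inj₁ (inj₁ (inj₂ (line-swap {4} (proj₂ ℓ₂₁ (z≈0 , α₂-g , α₁-gq)))))
        to (z≈0 , inj₂ α₂-g , inj₂ α₃-gq) = inj₁ (inj₂ (proj₂ ℓ₂₃ (z≈0 , α₂-g , α₃-gq)))
        to (z≈0 , inj₁ α-g  , inj₂ α₃-gq) =
          inj₂ (line-swap {4} (proj₂ ℓ₄₃ (z≈0 , through-aff-cong (sym (φ⁴-identity α)) α-g , α₃-gq)))
        from : Lines X → OnJoins (aff α) (aff α₂) X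
        from (inj₁ (inj₁ (inj₁ X∈ℓ))) = let (z≈0 , α-g , α₁-gq) = proj₁ ℓ₀₁ X∈ℓ in z≈0 , inj₁ α-g , inj₁ α₁-gq
        from (inj₁ (inj₁ (inj₂ X∈ℓ))) = let (z≈0 , α₂-g , α₁-gq) = proj₁ ℓ₂₁ (line-swap {4} X∈ℓ) in z≈0 , inj₂ α₂-g , inj₁ α₁-gq
        from (inj₁ (inj₂ X∈ℓ))         = let (z≈0 , α₂-g , α₃-gq) = proj₁ ℓ₂₃ X∈ℓ in z≈0 , inj₂ α₂-g , inj₂ α₃-gq
        from (inj₂ X∈ℓ)                = let (z≈0 , α₄-g , α₃-gq) = proj₁ ℓ₄₃ (line-swap {4} X∈ℓ)
                                         in z≈0 , inj₁ (through-aff-cong (φ⁴-identity α) α₄-g) , inj₂ α₃-gq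

    exterior-case : Exterior → (P : LPt Carrier) → RatL 4 P → OnConicL C P →
      EmptyPG 1 ([O] C ∩ Σ∞) × EmptyPG 2 ([O] C ∩ Σ∞)
      × SetEqPG 4 ([O] C ∩ Σ∞)
          (((Line 4 (gPt P) (Frob5^ 1 (gPt P)) ∪ Line 4 (Frob5^ 1 (gPt P)) (Frob5^ 2 (gPt P)))
            ∪ Line 4 (Frob5^ 2 (gPt P)) (Frob5^ 3 (gPt P)))
            ∪ Line 4 (Frob5^ 3 (gPt P)) (Frob5^ 4 (gPt P)))
    exterior-case exterior vert    _ P-on = ⊥-elim (exterior vert tt P-on)
    exterior-case exterior (aff α) _ P-on = empty-over-Fq , empty-over-Fq2 , four-lines
      where open ExteriorCase exterior α (on-aff→ C α P-on)

theorem4p3 : (q : ℕ) → IsPrimePower q → (K : FField) → HasOrder K (q ℕ.^ 4) →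
  (τ t0 t1 : FField.Carrier K) →
  let open FField K
      open Geometry K q τ
      open Spread t0 t1
  in
  -- τ is a primitive element of F_{q^2} with minimal polynomial x² − t1 x − t0 over F_q
  InF 2 τ →
  ((y : Carrier) → InF 2 y → ¬ (y ≈ 0#) → Σ ℕ λ i → y ≈ τ ^ i) →
  InF 1 t0 → InF 1 t1 → τ * τ ≈ t1 * τ + t0 →
  -- a non-degenerate conic of PG(2,q^2)
  (C : Conic Carrier) → ConicOver 2 C → NonDegenerate C →
  -- (1) secant
  ((P Q : LPt Carrier) → RatL 2 P → RatL 2 Q → ¬ (P ~L Q) →
    ((R : LPt Carrier) → RatL 2 R →
      (OnConicL C R → (R ~L P) ⊎ (R ~L Q)) × ((R ~L P) ⊎ (R ~L Q) → OnConicL C R)) →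
    SetEqPG 1 ([O] C ∩ Σ∞) ([ P ]^ 1 ∪ [ Q ]^ 1)
    × SetEqPG 2 ([O] C ∩ Σ∞)
        ((([ P ]^ 2 ∪ [ Q ]^ 2) ∪ Line 2 (gPt P) (Frob5 (gPt Q))) ∪ Line 2 (Frob5 (gPt P)) (gPt Q))
    × SetEqPG 4 ([O] C ∩ Σ∞)
        ((([ P ]^ 4 ∪ [ Q ]^ 4) ∪ Line 4 (gPt P) (Frob5 (gPt Q))) ∪ Line 4 (Frob5 (gPt P)) (gPt Q)))
  × -- (2) tangent
  ((P : LPt Carrier) → RatL 2 P →
    ((R : LPt Carrier) → RatL 2 R → (OnConicL C R → R ~L P) × (R ~L P → OnConicL C R)) →
    SetEqPG 1 ([O] C ∩ Σ∞) ([ P ]^ 1)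
    × SetEqPG 2 ([O] C ∩ Σ∞) ([ P ]^ 2)
    × SetEqPG 4 ([O] C ∩ Σ∞) ([ P ]^ 4))
  × -- (3) exterior
  (((R : LPt Carrier) → RatL 2 R → ¬ OnConicL C R) →
    (P : LPt Carrier) → RatL 4 P → OnConicL C P →
    EmptyPG 1 ([O] C ∩ Σ∞)
    × EmptyPG 2 ([O] C ∩ Σ∞)
    × SetEqPG 4 ([O] C ∩ Σ∞)
        (((Line 4 (gPt P) (Frob5^ 1 (gPt P)) ∪ Line 4 (Frob5^ 1 (gPt P)) (Frob5^ 2 (gPt P)))
          ∪ Line 4 (Frob5^ 2 (gPt P)) (Frob5^ 3 (gPt P)))
          ∪ Line 4 (Frob5^ 3 (gPt P)) (Frob5^ 4 (gPt P))))

-- In each case, factorise the conic on ℓ∞ and read off the lines.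
theorem4p3 q prime-power K order τ t0 t1 τ∈F2 generates t0∈F1 t1∈F1 τ-quadratic C C-over nondegenerate =
  (λ P Q P∈ Q∈ P≁Q secant →
     let (κ , κ≉0 , factorises) = secant-factorisation P Q P≁Q secant P∈ Q∈
     in secant-spreads P Q κ κ≉0 factorises ,
        secant-lines 2 τ∈F2 P Q κ κ≉0 factorises , secant-lines 4 (F2⊆F4 τ∈F2) P Q κ κ≉0 factorises) ,
  (λ P P∈ tangent →
     let (κ , κ≉0 , factorises) = tangent-factorisation P tangent P∈
     in tangent-spread 1 P κ κ≉0 factorises , tangent-spread 2 P κ κ≉0 factorises , tangent-spread 4 P κ κ≉0 factorises) ,
  exterior-case
  where
  τ-primitive : PrimePowerField.PrimitiveElement K q τ prime-power order t0 t1
  τ-primitive = record { generates = generates ; τ∈F2 = τ∈F2 ; t0∈F1 = t0∈F1 ; t1∈F1 = t1∈F1 ; τ-quadratic = τ-quadratic }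
  open BruckBose K q τ prime-power order t0 t1 τ-primitive using (F2⊆F4; module PointsAtInfinity)
  open PointsAtInfinity C C-over nondegenerate
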